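{- For every real $t$, as formal power series in $x$, $$\Phi_0(t,x)=\frac{\alpha(x)^t-\alpha(x)^{ -t}}{\sqrt{x^2+4}}=\frac{2\sinh\!\left(t\sinh^{ -1}\!\left(\tfrac{x}{2}\right)\right)}{\sqrt{x^2+4}}.$$
   Context: All series are formal power series in an indeterminate $x$ with real coefficients. For real $s$ and integer $m\ge 0$, $\binom{s}{m}=s(s-1)\cdots(s-m+1)/m!$. For real $s$ define $\Phi_0(s,x)=\sum_{k\ge 1}\binom{s/2+k-1}{2k-1}x^{2k-1}$ (equivalently, $\Phi_0(2t,x)=\sum_{k\ge1}\binom{t+k-1}{2k-1}x^{2k-1}$ for real $t$). Let $\sqrt{x^2+4}$ denote the formal power series $2\sum_{m\ge0}\binom{1/2}{m}(x^2/4)^m$, and let $\alpha(x)=\frac{x+\sqrt{x^2+4}}{2}$, a series with constant term $1$. For real $t$, $\alpha(x)^t:=\exp(t\log\alpha(x))$ as formal power series; equivalently $\alpha(x)^t=e^{t\sinh^{ -1}(x/2)}$, where $\sinh(y)=(e^y-e^{ -y})/2$ and $\sinh^{ -1}$ is its compositional inverse as a formal power series. -}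

module Defs where

open import Data.Nat as ℕ using (ℕ; zero; suc)
open import Data.Nat using (_!)
open import Data.Product using (Σ; ∃; _×_; _,_)
open import Data.Sum using (_⊎_)
open import Relation.Binary.PropositionalEquality using (_≡_)
open import Relation.Nullary using (¬_)

-- The real numbers, axiomatised as a complete ordered field.
-- (agda-stdlib has no reals; any model of these axioms is isomorphic to ℝ.)
-- The multiplicative inverse is a total function; its value at 0 is
-- unconstrained and never used.

record RealField : Set₁ where
  infixl 6 _+_
  infixl 7 _*_
  infix 4 _≤_
  field
    Carrier : Set
    0# 1#   : Carrier
    _+_ _*_ : Carrier → Carrier → Carrier
    -_      : Carrier → Carrier
    _⁻¹     : Carrier → Carrier
    _≤_     : Carrier → Carrier → Set
    +-assoc     : ∀ x y z → (x + y) + z ≡ x + (y + z)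
    +-comm      : ∀ x y → x + y ≡ y + x
    +-identityˡ : ∀ x → 0# + x ≡ x
    -‿inverseˡ  : ∀ x → (- x) + x ≡ 0#
    *-assoc     : ∀ x y z → (x * y) * z ≡ x * (y * z)
    *-comm      : ∀ x y → x * y ≡ y * x
    *-identityˡ : ∀ x → 1# * x ≡ x
    distribˡ    : ∀ x y z → x * (y + z) ≡ x * y + x * z
    0≢1         : ¬ (0# ≡ 1#)
    ⁻¹-inverseˡ : ∀ x → ¬ (x ≡ 0#) → (x ⁻¹) * x ≡ 1#
    ≤-refl    : ∀ x → x ≤ x
    ≤-trans   : ∀ {x y z} → x ≤ y → y ≤ z → x ≤ z
    ≤-antisym : ∀ {x y} → x ≤ y → y ≤ x → x ≡ y
    ≤-total   : ∀ x y → x ≤ y ⊎ y ≤ x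
    +-mono-≤  : ∀ {x y} z → x ≤ y → x + z ≤ y + z
    *-nonneg  : ∀ {x y} → 0# ≤ x → 0# ≤ y → 0# ≤ x * y
    lub : (P : Carrier → Set) → (∃ λ x → P x) → (∃ λ b → ∀ x → P x → x ≤ b) →
          ∃ λ s → (∀ x → P x → x ≤ s) × (∀ b → (∀ x → P x → x ≤ b) → s ≤ b)

module Series (ℝ : RealField) where
  open RealField ℝ public

  _-_ : Carrier → Carrier → Carrier
  x - y = x + (- y)

  fromℕ : ℕ → Carrier
  fromℕ zero    = 0#
  fromℕ (suc n) = 1# + fromℕ n

  2# : Carrier
  2# = fromℕ 2

  _^_ : Carrier → ℕ → Carrier
  x ^ zero  = 1#
  x ^ suc n = x * (x ^ n)

  sumTo : ℕ → (ℕ → Carrier) → Carrier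
  sumTo zero    f = f 0
  sumTo (suc n) f = sumTo n f + f (suc n)

  prodBelow : ℕ → (ℕ → Carrier) → Carrier
  prodBelow zero    f = 1#
  prodBelow (suc m) f = prodBelow m f * f m

  binom : Carrier → ℕ → Carrier
  binom s m = prodBelow m (λ i → s - fromℕ i) * (fromℕ (m !) ⁻¹)

  -- formal power series: coefficient of x^n
  FPS : Set
  FPS = ℕ → Carrier

  infix 4 _≈_
  _≈_ : FPS → FPS → Set
  f ≈ g = ∀ n → f n ≡ g n

  const : Carrier → FPS
  const c zero    = c
  const c (suc n) = 0#

  X : FPS
  X 1 = 1#
  X _ = 0#

  _⊕_ _⊖_ _⊛_ : FPS → FPS → FPS
  (f ⊕ g) n = f n + g n
  (f ⊖ g) n = f n - g n
  (f ⊛ g) n = sumTo n (λ i → f i * g (n ℕ.∸ i))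

  _·_ : Carrier → FPS → FPS
  (c · f) n = c * f n

  _^ˢ_ : FPS → ℕ → FPS
  f ^ˢ zero  = const 1#
  f ^ˢ suc n = f ⊛ (f ^ˢ n)

  -- composition f ∘ g, meaningful when g has zero constant term:
  -- coefficient N of Σ_n f_n g^n only involves n ≤ N.
  _∘ˢ_ : FPS → FPS → FPS
  (f ∘ˢ g) N = sumTo N (λ n → f n * (g ^ˢ n) N)

  -- multiplicative inverse of a series with invertible constant term:
  -- 1/a = a₀⁻¹ Σ_n (1 - a₀⁻¹ a)^n
  invˢ : FPS → FPS
  invˢ a N = (a 0 ⁻¹) * sumTo N (λ n → ((const 1# ⊖ ((a 0 ⁻¹) · a)) ^ˢ n) N)

  expSeries : FPS
  expSeries n = fromℕ (n !) ⁻¹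

  log1pSeries : FPS
  log1pSeries zero    = 0#
  log1pSeries (suc n) = ((- 1#) ^ n) * (fromℕ (suc n) ⁻¹)

  sinhSeries : FPS
  sinhSeries n = ((1# - ((- 1#) ^ n)) * (2# ⁻¹)) * (fromℕ (n !) ⁻¹)

  -- exp(y), log(1+y), sinh(y) for series y with zero constant term
  expˢ log1pˢ sinhˢ : FPS → FPS
  expˢ y = expSeries ∘ˢ y
  log1pˢ y = log1pSeries ∘ˢ y
  sinhˢ y = sinhSeries ∘ˢ y

  logˢ : FPS → FPS
  logˢ a = log1pˢ (a ⊖ const 1#)

  -- Φ₀(s,x) = Σ_{k≥1} binom(s/2+k-1, 2k-1) x^{2k-1}
  Φ₀ : Carrier → FPS
  Φ₀ s zero          = 0#
  Φ₀ s (suc zero)    = binom (s * (2# ⁻¹)) 1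
  Φ₀ s (suc (suc n)) = Φ₀' n
    where
    -- coefficient of x^{n+2}: odd iff n odd, n = 2j+1, k = j+2
    Φ₀' : ℕ → Carrier
    Φ₀' m with m ℕ.% 2
    ... | zero  = 0#
    ... | suc _ = binom (s * (2# ⁻¹) + fromℕ (suc (m ℕ./ 2))) (suc (suc m))

  -- √(x²+4) = 2 Σ_m binom(1/2,m) (x²/4)^m
  sqrtX²+4 : FPS
  sqrtX²+4 n with n ℕ.% 2
  ... | zero  = 2# * (binom (2# ⁻¹) (n ℕ./ 2) * ((fromℕ 4 ⁻¹) ^ (n ℕ./ 2)))
  ... | suc _ = 0#

  α : FPS
  α = (2# ⁻¹) · (X ⊕ sqrtX²+4)

  α^ : Carrier → FPS
  α^ t = expˢ (t · logˢ α)

  IsSinhInverse : FPS → Set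
  IsSinhInverse g = (g 0 ≡ 0#) × (sinhˢ g ≈ X) × (g ∘ˢ sinhSeries ≈ X)

-- Put α = (x + √(x²+4))/2 and L = log α. Differentiating, √(x²+4) L′ = 1, hence αᵗ = exp(t L)
-- satisfies √(x²+4) (αᵗ)′ = t αᵗ, and Ψ = (αᵗ - α⁻ᵗ)/√(x²+4) satisfies (x Ψ + (x²+4) Ψ′)′ = t² Ψ.
-- On coefficients this ODE is a two-step recurrence which Φ₀ also satisfies (by the absorption
-- identity (k+1) binom(w,k+1) = w binom(w-1,k)), and Φ₀ and Ψ both begin 0, t/2.
-- For the second form, sinh L = (α - α⁻¹)/2 = x/2, so every inverse of sinh maps x/2 to L.
-- Identities such as √(x²+4)² = x²+4 and exp L = α hold because both sides solve the same
-- linear ODE f′ = f h with the same constant term.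

module Submission where

open import Defs
open import Data.Product using (_×_; _,_)
open import Data.Nat as ℕ using (ℕ; zero; suc; z≤n; s≤s; NonZero)
  renaming (_≤_ to _≤ₙ_; _<_ to _<ₙ_)
import Data.Nat.Properties as ℕP
open import Data.Nat.DivMod using ([m+kn]%n≡m%n; m*n%n≡0; m*n/n≡m; m/n≡1+[m∸n]/n)
open import Data.Integer as ℤ using (ℤ; -[1+_])
import Data.Integer.Properties as ℤP
open import Data.Sign as Sign using (Sign)
open import Data.Sum using (inj₁; inj₂)
open import Data.Maybe using (Maybe; just; nothing)
open import Data.Empty using (⊥-elim)
open import Relation.Nullary using (¬_; yes; no)
open import Relation.Binary.PropositionalEquality
open import Algebra.Bundles using (CommutativeRing)
open import Algebra.Structures using (IsCommutativeRing)
open import Algebra.Solver.Ring.AlmostCommutativeRing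
  using (fromCommutativeRing; _-Raw-AlmostCommutative⟶_)

module Development (ℝ : RealField) where

  open Series ℝ
  open ≡-Reasoning

  -- Arithmetic in ℝ

  +-identityʳ : ∀ x → x + 0# ≡ x
  +-identityʳ x = trans (+-comm x 0#) (+-identityˡ x)

  -‿inverseʳ : ∀ x → x + (- x) ≡ 0#
  -‿inverseʳ x = trans (+-comm x (- x)) (-‿inverseˡ x)

  *-identityʳ : ∀ x → x * 1# ≡ x
  *-identityʳ x = trans (*-comm x 1#) (*-identityˡ x)

  distribʳ : ∀ x y z → (y + z) * x ≡ y * x + z * x
  distribʳ x y z = begin
    (y + z) * x     ≡⟨ *-comm (y + z) x ⟩
    x * (y + z)     ≡⟨ distribˡ x y z ⟩
    x * y + x * z   ≡⟨ cong₂ _+_ (*-comm x y) (*-comm x z) ⟩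
    y * x + z * x   ∎

  isCommutativeRing : IsCommutativeRing _≡_ _+_ _*_ -_ 0# 1#
  isCommutativeRing = record
    { isRing = record
      { +-isAbelianGroup = record
        { isGroup = record
          { isMonoid = record
            { isSemigroup = record
              { isMagma = record { isEquivalence = isEquivalence ; ∙-cong = cong₂ _+_ }
              ; assoc = +-assoc }
            ; identity = +-identityˡ , +-identityʳ }
          ; inverse = -‿inverseˡ , -‿inverseʳ
          ; ⁻¹-cong = cong (λ z → - z) }
        ; comm = +-comm }
      ; *-cong = cong₂ _*_
      ; *-assoc = *-assoc
      ; *-identity = *-identityˡ , *-identityʳ
      ; distrib = distribˡ , distribʳ }
    ; *-comm = *-comm }

  commutativeRing : CommutativeRing _ _
  commutativeRing = record { isCommutativeRing = isCommutativeRing }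

  open CommutativeRing commutativeRing public using (zeroˡ; zeroʳ)
  open import Algebra.Properties.Ring (CommutativeRing.ring commutativeRing)
    using (-‿distribˡ-*; -‿involutive; -0#≈0#; -‿+-comm; -1*x≈-x)
  open import Algebra.Properties.CommutativeSemigroup
    (CommutativeRing.*-commutativeSemigroup commutativeRing)
    using () renaming (interchange to *-interchange)
  open import Algebra.Properties.CommutativeSemigroup
    (CommutativeRing.+-commutativeSemigroup commutativeRing)
    using () renaming (interchange to +-interchange)

  fromℕ-+ : ∀ m n → fromℕ (m ℕ.+ n) ≡ fromℕ m + fromℕ n
  fromℕ-+ zero    n = sym (+-identityˡ _)
  fromℕ-+ (suc m) n = trans (cong (1# +_) (fromℕ-+ m n)) (sym (+-assoc _ _ _))

  fromℕ-* : ∀ m n → fromℕ (m ℕ.* n) ≡ fromℕ m * fromℕ n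
  fromℕ-* zero    n = sym (zeroˡ _)
  fromℕ-* (suc m) n = begin
    fromℕ (n ℕ.+ m ℕ.* n)               ≡⟨ fromℕ-+ n (m ℕ.* n) ⟩
    fromℕ n + fromℕ (m ℕ.* n)           ≡⟨ cong₂ _+_ (sym (*-identityˡ _)) (fromℕ-* m n) ⟩
    1# * fromℕ n + fromℕ m * fromℕ n    ≡⟨ sym (distribʳ _ _ _) ⟩
    (1# + fromℕ m) * fromℕ n            ∎

  fromℤ : ℤ → Carrier
  fromℤ (ℤ.+ n)    = fromℕ n
  fromℤ -[1+ n ]   = - fromℕ (suc n)

  fromℤ-⊖ : ∀ m n → fromℤ (m ℤ.⊖ n) ≡ fromℕ m - fromℕ n
  fromℤ-⊖ m zero = begin
    fromℤ (m ℤ.⊖ 0)  ≡⟨ cong fromℤ (ℤP.⊖-≥ {m} {0} z≤n) ⟩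
    fromℕ m          ≡⟨ sym (+-identityʳ _) ⟩
    fromℕ m + 0#     ≡⟨ cong (fromℕ m +_) (sym -0#≈0#) ⟩
    fromℕ m - 0#     ∎
  fromℤ-⊖ zero (suc n) =
    trans (cong fromℤ (ℤP.⊖-< {0} {suc n} (s≤s z≤n))) (sym (+-identityˡ _))
  fromℤ-⊖ (suc m) (suc n) = begin
    fromℤ (suc m ℤ.⊖ suc n)          ≡⟨ cong fromℤ (ℤP.[1+m]⊖[1+n]≡m⊖n m n) ⟩
    fromℤ (m ℤ.⊖ n)                  ≡⟨ fromℤ-⊖ m n ⟩
    fromℕ m - fromℕ n                ≡⟨ cong (_+ - fromℕ n) (sym (1+x-1≡x (fromℕ m))) ⟩
    (1# + fromℕ m) + - 1# + - fromℕ n ≡⟨ +-assoc _ _ _ ⟩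
    (1# + fromℕ m) + (- 1# + - fromℕ n) ≡⟨ cong ((1# + fromℕ m) +_) (-‿+-comm 1# (fromℕ n)) ⟩
    (1# + fromℕ m) - (1# + fromℕ n)  ∎
    where
    1+x-1≡x : ∀ x → (1# + x) + - 1# ≡ x
    1+x-1≡x x = begin
      (1# + x) + - 1#    ≡⟨ +-comm _ _ ⟩
      - 1# + (1# + x)    ≡⟨ sym (+-assoc _ _ _) ⟩
      (- 1# + 1#) + x    ≡⟨ cong (_+ x) (-‿inverseˡ 1#) ⟩
      0# + x             ≡⟨ +-identityˡ x ⟩
      x                  ∎

  fromℤ-neg : ∀ i → fromℤ (ℤ.- i) ≡ - fromℤ i
  fromℤ-neg (ℤ.+ zero)  = sym -0#≈0#
  fromℤ-neg (ℤ.+ suc n) = refl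
  fromℤ-neg -[1+ n ]    = sym (-‿involutive _)

  fromℤ-+ : ∀ i j → fromℤ (i ℤ.+ j) ≡ fromℤ i + fromℤ j
  fromℤ-+ -[1+ m ] -[1+ n ] = begin
    - (1# + fromℕ (suc (m ℕ.+ n)))        ≡⟨ cong (λ z → - (1# + z)) (fromℕ-+ (suc m) n) ⟩
    - (1# + (fromℕ (suc m) + fromℕ n))    ≡⟨ cong (λ z → - z) (sym (+-assoc _ _ _)) ⟩
    - ((1# + fromℕ (suc m)) + fromℕ n)    ≡⟨ cong (λ z → - (z + fromℕ n)) (+-comm _ _) ⟩
    - ((fromℕ (suc m) + 1#) + fromℕ n)    ≡⟨ cong (λ z → - z) (+-assoc _ _ _) ⟩
    - (fromℕ (suc m) + fromℕ (suc n))     ≡⟨ sym (-‿+-comm _ _) ⟩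
    - fromℕ (suc m) + - fromℕ (suc n)     ∎
  fromℤ-+ -[1+ m ] (ℤ.+ n)  = trans (fromℤ-⊖ n (suc m)) (+-comm _ _)
  fromℤ-+ (ℤ.+ m) -[1+ n ]  = fromℤ-⊖ m (suc n)
  fromℤ-+ (ℤ.+ m) (ℤ.+ n)   = fromℕ-+ m n

  fromSign : Sign → Carrier
  fromSign Sign.+ = 1#
  fromSign Sign.- = - 1#

  fromSign-* : ∀ s t → fromSign (s Sign.* t) ≡ fromSign s * fromSign t
  fromSign-* Sign.- Sign.- = sym (trans (-1*x≈-x (- 1#)) (-‿involutive 1#))
  fromSign-* Sign.- Sign.+ = sym (*-identityʳ _)
  fromSign-* Sign.+ Sign.- = sym (*-identityˡ _)
  fromSign-* Sign.+ Sign.+ = sym (*-identityˡ _)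

  fromℤ-◃ : ∀ s n → fromℤ (s ℤ.◃ n) ≡ fromSign s * fromℕ n
  fromℤ-◃ s       zero    = sym (zeroʳ _)
  fromℤ-◃ Sign.+  (suc n) = sym (*-identityˡ _)
  fromℤ-◃ Sign.-  (suc n) = sym (-1*x≈-x _)

  fromℤ-sign-abs : ∀ i → fromℤ i ≡ fromSign (ℤ.sign i) * fromℕ ℤ.∣ i ∣
  fromℤ-sign-abs (ℤ.+ n)  = sym (*-identityˡ _)
  fromℤ-sign-abs -[1+ n ] = sym (-1*x≈-x _)

  fromℤ-* : ∀ i j → fromℤ (i ℤ.* j) ≡ fromℤ i * fromℤ j
  fromℤ-* i j = begin
    fromℤ ((ℤ.sign i Sign.* ℤ.sign j) ℤ.◃ (ℤ.∣ i ∣ ℕ.* ℤ.∣ j ∣))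
      ≡⟨ fromℤ-◃ (ℤ.sign i Sign.* ℤ.sign j) (ℤ.∣ i ∣ ℕ.* ℤ.∣ j ∣) ⟩
    fromSign (ℤ.sign i Sign.* ℤ.sign j) * fromℕ (ℤ.∣ i ∣ ℕ.* ℤ.∣ j ∣)
      ≡⟨ cong₂ _*_ (fromSign-* (ℤ.sign i) (ℤ.sign j)) (fromℕ-* ℤ.∣ i ∣ ℤ.∣ j ∣) ⟩
    (fromSign (ℤ.sign i) * fromSign (ℤ.sign j)) * (fromℕ ℤ.∣ i ∣ * fromℕ ℤ.∣ j ∣)
      ≡⟨ *-interchange _ _ _ _ ⟩
    (fromSign (ℤ.sign i) * fromℕ ℤ.∣ i ∣) * (fromSign (ℤ.sign j) * fromℕ ℤ.∣ j ∣)
      ≡⟨ sym (cong₂ _*_ (fromℤ-sign-abs i) (fromℤ-sign-abs j)) ⟩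
    fromℤ i * fromℤ j ∎

  fromℤ-homomorphism :
    ℤ.+-*-rawRing -Raw-AlmostCommutative⟶ fromCommutativeRing commutativeRing
  fromℤ-homomorphism = record
    { ⟦_⟧ = fromℤ ; +-homo = fromℤ-+ ; *-homo = fromℤ-* ; -‿homo = fromℤ-neg
    ; 0-homo = refl ; 1-homo = +-identityʳ 1# }

  fromℤ-≟ : ∀ i j → Maybe (fromℤ i ≡ fromℤ j)
  fromℤ-≟ i j with i ℤ.≟ j
  ... | yes i≡j = just (cong fromℤ i≡j)
  ... | no _    = nothing

  open import Algebra.Solver.Ring ℤ.+-*-rawRing
    (fromCommutativeRing commutativeRing) fromℤ-homomorphism fromℤ-≟
    using (solve; _:=_; con; _:+_; _:*_; :-_; _:-_)

  sumTo-cong≤ : ∀ n {f g : ℕ → Carrier} → (∀ i → i ≤ₙ n → f i ≡ g i) → sumTo n f ≡ sumTo n g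
  sumTo-cong≤ zero    f≡g = f≡g 0 z≤n
  sumTo-cong≤ (suc n) f≡g =
    cong₂ _+_ (sumTo-cong≤ n (λ i i≤n → f≡g i (ℕP.m≤n⇒m≤1+n i≤n))) (f≡g (suc n) ℕP.≤-refl)

  sumTo-cong : ∀ n {f g : ℕ → Carrier} → (∀ i → f i ≡ g i) → sumTo n f ≡ sumTo n g
  sumTo-cong n f≡g = sumTo-cong≤ n (λ i _ → f≡g i)

  sumTo-+ : ∀ n f g → sumTo n (λ i → f i + g i) ≡ sumTo n f + sumTo n g
  sumTo-+ zero    f g = refl
  sumTo-+ (suc n) f g = trans (cong (_+ (f (suc n) + g (suc n))) (sumTo-+ n f g)) (+-interchange _ _ _ _)

  *-distribˡ-sumTo : ∀ n c f → c * sumTo n f ≡ sumTo n (λ i → c * f i)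
  *-distribˡ-sumTo zero    c f = refl
  *-distribˡ-sumTo (suc n) c f = trans (distribˡ c _ _) (cong (_+ (c * f (suc n))) (*-distribˡ-sumTo n c f))

  *-distribʳ-sumTo : ∀ n c f → sumTo n f * c ≡ sumTo n (λ i → f i * c)
  *-distribʳ-sumTo n c f =
    trans (*-comm _ c) (trans (*-distribˡ-sumTo n c f) (sumTo-cong n (λ i → *-comm c (f i))))

  -‿distrib-sumTo : ∀ n f → - sumTo n f ≡ sumTo n (λ i → - f i)
  -‿distrib-sumTo zero    f = refl
  -‿distrib-sumTo (suc n) f =
    trans (sym (-‿+-comm _ _)) (cong (_+ (- f (suc n))) (-‿distrib-sumTo n f))

  sumTo-zero : ∀ n {f} → (∀ i → i ≤ₙ n → f i ≡ 0#) → sumTo n f ≡ 0#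
  sumTo-zero n f≡0 = trans (sumTo-cong≤ n f≡0) (sumTo-const0 n)
    where
    sumTo-const0 : ∀ n → sumTo n (λ _ → 0#) ≡ 0#
    sumTo-const0 zero    = refl
    sumTo-const0 (suc n) = trans (+-identityʳ _) (sumTo-const0 n)

  sumTo-suc : ∀ n f → sumTo (suc n) f ≡ f 0 + sumTo n (λ i → f (suc i))
  sumTo-suc zero    f = refl
  sumTo-suc (suc n) f = trans (cong (_+ f (suc (suc n))) (sumTo-suc n f)) (+-assoc _ _ _)

  sumTo-extend : ∀ n m {f} → n ≤ₙ m → (∀ i → n <ₙ i → i ≤ₙ m → f i ≡ 0#) → sumTo m f ≡ sumTo n f
  sumTo-extend zero zero z≤n _ = refl
  sumTo-extend n (suc m) {f} n≤1+m f≡0 with ℕP.m≤n⇒m<n∨m≡n n≤1+m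
  ... | inj₁ (s≤s n≤m) = begin
    sumTo m f + f (suc m)
      ≡⟨ cong₂ _+_ (sumTo-extend n m n≤m (λ i n<i i≤m → f≡0 i n<i (ℕP.m≤n⇒m≤1+n i≤m)))
                   (f≡0 (suc m) (s≤s n≤m) ℕP.≤-refl) ⟩
    sumTo n f + 0#  ≡⟨ +-identityʳ _ ⟩
    sumTo n f       ∎
  ... | inj₂ refl = refl

  sumTo-reverse : ∀ n f → sumTo n (λ i → f (n ℕ.∸ i)) ≡ sumTo n f
  sumTo-reverse zero    f = refl
  sumTo-reverse (suc n) f = begin
    sumTo (suc n) (λ i → f (suc n ℕ.∸ i))  ≡⟨ sumTo-suc n _ ⟩
    f (suc n) + sumTo n (λ i → f (n ℕ.∸ i)) ≡⟨ cong (f (suc n) +_) (sumTo-reverse n f) ⟩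
    f (suc n) + sumTo n f                  ≡⟨ +-comm _ _ ⟩
    sumTo (suc n) f                        ∎

  sumTo-swap : ∀ n m (F : ℕ → ℕ → Carrier) →
    sumTo n (λ i → sumTo m (F i)) ≡ sumTo m (λ j → sumTo n (λ i → F i j))
  sumTo-swap zero    m F = refl
  sumTo-swap (suc n) m F = begin
    sumTo n (λ i → sumTo m (F i)) + sumTo m (F (suc n))
      ≡⟨ cong (_+ sumTo m (F (suc n))) (sumTo-swap n m F) ⟩
    sumTo m (λ j → sumTo n (λ i → F i j)) + sumTo m (F (suc n))
      ≡⟨ sym (sumTo-+ m _ _) ⟩
    sumTo m (λ j → sumTo n (λ i → F i j) + F (suc n) j) ∎

  sumTo-*-sumTo : ∀ n m (f g : ℕ → Carrier) →
    sumTo n f * sumTo m g ≡ sumTo n (λ a → sumTo m (λ b → f a * g b))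
  sumTo-*-sumTo n m f g = trans (*-distribʳ-sumTo n _ f) (sumTo-cong n (λ a → *-distribˡ-sumTo m (f a) g))

  sumTo-triangle : ∀ n (F : ℕ → ℕ → Carrier) →
    sumTo n (λ i → sumTo i (F i)) ≡ sumTo n (λ j → sumTo (n ℕ.∸ j) (λ k → F (j ℕ.+ k) j))
  sumTo-triangle zero    F = refl
  sumTo-triangle (suc n) F = begin
    sumTo n (λ i → sumTo i (F i)) + (sumTo n (F (suc n)) + F (suc n) (suc n))
      ≡⟨ cong (_+ (sumTo n (F (suc n)) + F (suc n) (suc n))) (sumTo-triangle n F) ⟩
    sumTo n column + (sumTo n (F (suc n)) + F (suc n) (suc n))
      ≡⟨ sym (+-assoc _ _ _) ⟩
    (sumTo n column + sumTo n (F (suc n))) + F (suc n) (suc n)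
      ≡⟨ cong (_+ F (suc n) (suc n)) (trans (sym (sumTo-+ n _ _)) (sumTo-cong≤ n extend-column)) ⟩
    sumTo n (λ j → sumTo (suc n ℕ.∸ j) (λ k → F (j ℕ.+ k) j)) + F (suc n) (suc n)
      ≡⟨ cong (sumTo n (λ j → sumTo (suc n ℕ.∸ j) (λ k → F (j ℕ.+ k) j)) +_) diagonal ⟩
    sumTo (suc n) (λ j → sumTo (suc n ℕ.∸ j) (λ k → F (j ℕ.+ k) j)) ∎
    where
    column : ℕ → Carrier
    column j = sumTo (n ℕ.∸ j) (λ k → F (j ℕ.+ k) j)
    diagonal : F (suc n) (suc n) ≡ sumTo (n ℕ.∸ n) (λ k → F (suc n ℕ.+ k) (suc n))
    diagonal = begin
      F (suc n) (suc n)                          ≡⟨ cong (λ m → F m (suc n)) (sym (ℕP.+-identityʳ (suc n))) ⟩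
      sumTo 0 (λ k → F (suc n ℕ.+ k) (suc n))    ≡⟨ cong (λ m → sumTo m (λ k → F (suc n ℕ.+ k) (suc n))) (sym (ℕP.n∸n≡0 n)) ⟩
      sumTo (n ℕ.∸ n) (λ k → F (suc n ℕ.+ k) (suc n)) ∎
    extend-column : ∀ j → j ≤ₙ n → column j + F (suc n) j ≡ sumTo (suc n ℕ.∸ j) (λ k → F (j ℕ.+ k) j)
    extend-column j j≤n = begin
      column j + F (suc n) j
        ≡⟨ cong (λ m → column j + F m j)
                (sym (trans (ℕP.+-suc j (n ℕ.∸ j)) (cong suc (ℕP.m+[n∸m]≡n j≤n)))) ⟩
      sumTo (suc (n ℕ.∸ j)) (λ k → F (j ℕ.+ k) j)
        ≡⟨ cong (λ m → sumTo m (λ k → F (j ℕ.+ k) j)) (sym (ℕP.+-∸-assoc 1 j≤n)) ⟩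
      sumTo (suc n ℕ.∸ j) (λ k → F (j ℕ.+ k) j) ∎

  sumTo-single : ∀ n k {f} → k ≤ₙ n → (∀ i → i ≤ₙ n → ¬ (i ≡ k) → f i ≡ 0#) → sumTo n f ≡ f k
  sumTo-single zero zero z≤n _ = refl
  sumTo-single (suc n) k {f} k≤1+n f≡0 with ℕP.m≤n⇒m<n∨m≡n k≤1+n
  ... | inj₁ (s≤s k≤n) = trans
    (cong₂ _+_ (sumTo-single n k k≤n (λ i i≤n → f≡0 i (ℕP.m≤n⇒m≤1+n i≤n)))
               (f≡0 (suc n) ℕP.≤-refl (λ e → ℕP.<-irrefl (sym e) (s≤s k≤n))))
    (+-identityʳ _)
  ... | inj₂ refl = trans
    (cong (_+ f (suc n)) (sumTo-zero n (λ i i≤n → f≡0 i (ℕP.m≤n⇒m≤1+n i≤n) (λ e → ℕP.<-irrefl e (s≤s i≤n)))))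
    (+-identityˡ _)

  sumTo-telescope : ∀ N (a : ℕ → Carrier) → sumTo N (λ n → a n - a (suc n)) ≡ a 0 - a (suc N)
  sumTo-telescope zero    a = refl
  sumTo-telescope (suc N) a = trans (cong (_+ (a (suc N) - a (suc (suc N)))) (sumTo-telescope N a))
    (solve 3 (λ x y z → (x :- y) :+ (y :- z) := x :- z) refl _ _ _)

  0≤1 : 0# ≤ 1#
  0≤1 with ≤-total 0# 1#
  ... | inj₁ 0≤1 = 0≤1
  ... | inj₂ 1≤0 = subst (0# ≤_) (trans (-1*x≈-x (- 1#)) (-‿involutive 1#)) (*-nonneg 0≤-1 0≤-1)
    where
    0≤-1 : 0# ≤ - 1#
    0≤-1 = subst₂ _≤_ (-‿inverseʳ 1#) (+-identityˡ (- 1#)) (+-mono-≤ (- 1#) 1≤0)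

  0≤fromℕ : ∀ n → 0# ≤ fromℕ n
  0≤fromℕ zero    = ≤-refl 0#
  0≤fromℕ (suc n) = ≤-trans 0≤1 (subst₂ _≤_ (+-identityˡ 1#) (+-comm _ _) (+-mono-≤ 1# (0≤fromℕ n)))

  fromℕ-suc≢0 : ∀ n → ¬ (fromℕ (suc n) ≡ 0#)
  fromℕ-suc≢0 n e =
    0≢1 (≤-antisym 0≤1 (subst₂ _≤_ (+-identityˡ 1#) (trans (+-comm _ _) e) (+-mono-≤ 1# (0≤fromℕ n))))

  fromℕ≢0 : ∀ n → .{{NonZero n}} → ¬ (fromℕ n ≡ 0#)
  fromℕ≢0 (suc n) = fromℕ-suc≢0 n

  fromℕ-!≢0 : ∀ n → ¬ (fromℕ (n ℕ.!) ≡ 0#)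
  fromℕ-!≢0 n = fromℕ≢0 (n ℕ.!) {{ℕP._!≢0 n}}

  fromℕ-1 : fromℕ 1 ≡ 1#
  fromℕ-1 = +-identityʳ 1#

  ⁻¹-inverseʳ : ∀ x → ¬ (x ≡ 0#) → x * (x ⁻¹) ≡ 1#
  ⁻¹-inverseʳ x x≢0 = trans (*-comm _ _) (⁻¹-inverseˡ x x≢0)

  *-cancelˡ : ∀ c {a b} → ¬ (c ≡ 0#) → c * a ≡ c * b → a ≡ b
  *-cancelˡ c {a} {b} c≢0 e = begin
    a                ≡⟨ sym (*-identityˡ a) ⟩
    1# * a           ≡⟨ cong (_* a) (sym (⁻¹-inverseˡ c c≢0)) ⟩
    (c ⁻¹ * c) * a   ≡⟨ *-assoc _ _ _ ⟩
    c ⁻¹ * (c * a)   ≡⟨ cong (c ⁻¹ *_) e ⟩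
    c ⁻¹ * (c * b)   ≡⟨ sym (*-assoc _ _ _) ⟩
    (c ⁻¹ * c) * b   ≡⟨ cong (_* b) (⁻¹-inverseˡ c c≢0) ⟩
    1# * b           ≡⟨ *-identityˡ b ⟩
    b                ∎

  *-≢0 : ∀ a b → ¬ (a ≡ 0#) → ¬ (b ≡ 0#) → ¬ (a * b ≡ 0#)
  *-≢0 a b a≢0 b≢0 ab≡0 = b≢0 (*-cancelˡ a a≢0 (trans ab≡0 (sym (zeroʳ a))))

  ⁻¹-unique : ∀ a b → ¬ (a ≡ 0#) → a * b ≡ 1# → b ≡ a ⁻¹
  ⁻¹-unique a b a≢0 ab≡1 = *-cancelˡ a a≢0 (trans ab≡1 (sym (⁻¹-inverseʳ a a≢0)))

  ⁻¹-* : ∀ a b → ¬ (a ≡ 0#) → ¬ (b ≡ 0#) → (a * b) ⁻¹ ≡ a ⁻¹ * b ⁻¹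
  ⁻¹-* a b a≢0 b≢0 = sym (⁻¹-unique (a * b) _ (*-≢0 a b a≢0 b≢0)
    (trans (*-interchange a b (a ⁻¹) (b ⁻¹))
           (trans (cong₂ _*_ (⁻¹-inverseʳ a a≢0) (⁻¹-inverseʳ b b≢0)) (*-identityˡ 1#))))

  fromℕ-1⁻¹ : fromℕ 1 ⁻¹ ≡ 1#
  fromℕ-1⁻¹ = sym (⁻¹-unique (fromℕ 1) 1# (fromℕ-suc≢0 0) (trans (*-identityʳ _) fromℕ-1))

  ½ ¼ : Carrier
  ½ = 2# ⁻¹
  ¼ = fromℕ 4 ⁻¹

  2*½≡1 : 2# * ½ ≡ fromℕ 1
  2*½≡1 = trans (⁻¹-inverseʳ 2# (fromℕ-suc≢0 1)) (sym fromℕ-1)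

  -- Formal power series

  -- A record rather than Defs' pointwise _≈_, so that both sides can be inferred.
  infix 4 _≋_
  record _≋_ (f g : FPS) : Set where
    constructor mk≋
    field at : ∀ n → f n ≡ g n
  open _≋_ public

  ≋-refl : ∀ {f} → f ≋ f
  ≋-refl = mk≋ λ _ → refl

  ≋-sym : ∀ {f g} → f ≋ g → g ≋ f
  ≋-sym f≋g = mk≋ λ n → sym (at f≋g n)

  ≋-trans : ∀ {f g h} → f ≋ g → g ≋ h → f ≋ h
  ≋-trans f≋g g≋h = mk≋ λ n → trans (at f≋g n) (at g≋h n)

  infixr 2 _≋⟨_⟩_
  infix  3 _∎ˢ

  _≋⟨_⟩_ : ∀ f {g h} → f ≋ g → g ≋ h → f ≋ h
  f ≋⟨ f≋g ⟩ g≋h = ≋-trans f≋g g≋h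

  _∎ˢ : ∀ f → f ≋ f
  f ∎ˢ = ≋-refl

  0ˢ 1ˢ : FPS
  0ˢ _ = 0#
  1ˢ   = const 1#

  D : FPS → FPS
  D f n = fromℕ (suc n) * f (suc n)

  ⊕-cong : ∀ {f f′ g g′} → f ≋ f′ → g ≋ g′ → f ⊕ g ≋ f′ ⊕ g′
  ⊕-cong p q = mk≋ λ n → cong₂ _+_ (at p n) (at q n)

  ⊖-cong : ∀ {f f′ g g′} → f ≋ f′ → g ≋ g′ → f ⊖ g ≋ f′ ⊖ g′
  ⊖-cong p q = mk≋ λ n → cong₂ _-_ (at p n) (at q n)

  ·-congʳ : ∀ c {f f′} → f ≋ f′ → c · f ≋ c · f′
  ·-congʳ c p = mk≋ λ n → cong (c *_) (at p n)

  ·-congˡ : ∀ {c c′} → c ≡ c′ → ∀ f → c · f ≋ c′ · f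
  ·-congˡ c≡c′ f = mk≋ λ n → cong (_* f n) c≡c′

  ⊛-cong : ∀ {f f′ g g′} → f ≋ f′ → g ≋ g′ → f ⊛ g ≋ f′ ⊛ g′
  ⊛-cong p q = mk≋ λ n → sumTo-cong n (λ i → cong₂ _*_ (at p i) (at q (n ℕ.∸ i)))

  ⊛-congˡ : ∀ {f f′} → f ≋ f′ → ∀ g → f ⊛ g ≋ f′ ⊛ g
  ⊛-congˡ p g = ⊛-cong p (≋-refl {g})

  ⊛-congʳ : ∀ f {g g′} → g ≋ g′ → f ⊛ g ≋ f ⊛ g′
  ⊛-congʳ f q = ⊛-cong (≋-refl {f}) q

  ^ˢ-cong : ∀ {f g} n → f ≋ g → f ^ˢ n ≋ g ^ˢ n
  ^ˢ-cong zero    p = ≋-refl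
  ^ˢ-cong (suc n) p = ⊛-cong p (^ˢ-cong n p)

  D-cong : ∀ {f g} → f ≋ g → D f ≋ D g
  D-cong p = mk≋ λ n → cong (fromℕ (suc n) *_) (at p (suc n))

  ⊛-comm : ∀ f g → f ⊛ g ≋ g ⊛ f
  ⊛-comm f g = mk≋ λ n → begin
    sumTo n (λ i → f i * g (n ℕ.∸ i))                  ≡⟨ sym (sumTo-reverse n _) ⟩
    sumTo n (λ i → f (n ℕ.∸ i) * g (n ℕ.∸ (n ℕ.∸ i)))  ≡⟨ sumTo-cong≤ n (λ i i≤n →
      trans (*-comm _ _) (cong (λ m → g m * f (n ℕ.∸ i)) (ℕP.m∸[m∸n]≡n i≤n))) ⟩
    sumTo n (λ i → g i * f (n ℕ.∸ i))                  ∎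

  ⊛-assoc : ∀ f g h → (f ⊛ g) ⊛ h ≋ f ⊛ (g ⊛ h)
  ⊛-assoc f g h = mk≋ λ n → begin
    sumTo n (λ i → sumTo i (λ j → f j * g (i ℕ.∸ j)) * h (n ℕ.∸ i))
      ≡⟨ sumTo-cong n (λ i → *-distribʳ-sumTo i _ _) ⟩
    sumTo n (λ i → sumTo i (λ j → f j * g (i ℕ.∸ j) * h (n ℕ.∸ i)))
      ≡⟨ sumTo-triangle n _ ⟩
    sumTo n (λ j → sumTo (n ℕ.∸ j) (λ k → f j * g (j ℕ.+ k ℕ.∸ j) * h (n ℕ.∸ (j ℕ.+ k))))
      ≡⟨ sumTo-cong n (λ j → trans (sumTo-cong (n ℕ.∸ j) (λ k → trans
           (cong₂ (λ a b → f j * g a * h b) (ℕP.m+n∸m≡n j k) (sym (ℕP.∸-+-assoc n j k)))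
           (*-assoc _ _ _)))
         (sym (*-distribˡ-sumTo (n ℕ.∸ j) (f j) _))) ⟩
    sumTo n (λ j → f j * sumTo (n ℕ.∸ j) (λ k → g k * h (n ℕ.∸ j ℕ.∸ k)))
      ∎

  ⊛-distribˡ-⊕ : ∀ f g h → f ⊛ (g ⊕ h) ≋ (f ⊛ g) ⊕ (f ⊛ h)
  ⊛-distribˡ-⊕ f g h = mk≋ λ n → trans (sumTo-cong n (λ i → distribˡ _ _ _)) (sumTo-+ n _ _)

  ⊛-distribʳ-⊕ : ∀ f g h → (g ⊕ h) ⊛ f ≋ (g ⊛ f) ⊕ (h ⊛ f)
  ⊛-distribʳ-⊕ f g h =
    ≋-trans (⊛-comm _ _) (≋-trans (⊛-distribˡ-⊕ f g h) (⊕-cong (⊛-comm f g) (⊛-comm f h)))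

  ⊛-distribˡ-⊖ : ∀ f g h → f ⊛ (g ⊖ h) ≋ (f ⊛ g) ⊖ (f ⊛ h)
  ⊛-distribˡ-⊖ f g h = mk≋ λ n → begin
    sumTo n (λ i → f i * (g (n ℕ.∸ i) - h (n ℕ.∸ i)))
      ≡⟨ sumTo-cong n (λ i → solve 3 (λ a b c → a :* (b :- c) := a :* b :+ :- (a :* c)) refl (f i) _ _) ⟩
    sumTo n (λ i → f i * g (n ℕ.∸ i) + - (f i * h (n ℕ.∸ i)))
      ≡⟨ sumTo-+ n _ _ ⟩
    (f ⊛ g) n + sumTo n (λ i → - (f i * h (n ℕ.∸ i)))
      ≡⟨ cong ((f ⊛ g) n +_) (sym (-‿distrib-sumTo n _)) ⟩
    ((f ⊛ g) ⊖ (f ⊛ h)) n ∎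

  ⊛-distribʳ-⊖ : ∀ f g h → (g ⊖ h) ⊛ f ≋ (g ⊛ f) ⊖ (h ⊛ f)
  ⊛-distribʳ-⊖ f g h =
    ≋-trans (⊛-comm _ _) (≋-trans (⊛-distribˡ-⊖ f g h) (⊖-cong (⊛-comm f g) (⊛-comm f h)))

  ⊛-·ʳ : ∀ c f g → f ⊛ (c · g) ≋ c · (f ⊛ g)
  ⊛-·ʳ c f g = mk≋ λ n → trans
    (sumTo-cong n (λ i → solve 3 (λ a b c → a :* (c :* b) := c :* (a :* b)) refl (f i) (g (n ℕ.∸ i)) c))
    (sym (*-distribˡ-sumTo n c _))

  ⊛-·ˡ : ∀ c f g → (c · f) ⊛ g ≋ c · (f ⊛ g)
  ⊛-·ˡ c f g = ≋-trans (⊛-comm _ _) (≋-trans (⊛-·ʳ c g f) (·-congʳ c (⊛-comm g f)))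

  ·-assoc : ∀ c d f → c · (d · f) ≋ (c * d) · f
  ·-assoc c d f = mk≋ λ _ → sym (*-assoc _ _ _)

  const-⊛ : ∀ c f → const c ⊛ f ≋ c · f
  const-⊛ c f = mk≋ λ n → sumTo-single n 0 z≤n (vanish n)
    where
    vanish : ∀ n i → i ≤ₙ n → ¬ (i ≡ 0) → const c i * f (n ℕ.∸ i) ≡ 0#
    vanish n zero    _ i≢0 = ⊥-elim (i≢0 refl)
    vanish n (suc i) _ _   = zeroˡ _

  ⊛-identityˡ : ∀ f → 1ˢ ⊛ f ≋ f
  ⊛-identityˡ f = mk≋ λ n → trans (at (const-⊛ 1# f) n) (*-identityˡ _)

  ⊛-identityʳ : ∀ f → f ⊛ 1ˢ ≋ f
  ⊛-identityʳ f = ≋-trans (⊛-comm f 1ˢ) (⊛-identityˡ f)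

  ⊛-zeroʳ : ∀ f → f ⊛ 0ˢ ≋ 0ˢ
  ⊛-zeroʳ f = mk≋ λ n → sumTo-zero n (λ _ _ → zeroʳ _)

  X-⊛-0 : ∀ f → (X ⊛ f) 0 ≡ 0#
  X-⊛-0 f = zeroˡ _

  X-⊛-suc : ∀ f n → (X ⊛ f) (suc n) ≡ f n
  X-⊛-suc f n = trans (sumTo-single (suc n) 1 (s≤s z≤n) vanish) (*-identityˡ _)
    where
    vanish : ∀ i → i ≤ₙ suc n → ¬ (i ≡ 1) → X i * f (suc n ℕ.∸ i) ≡ 0#
    vanish zero          _ _   = zeroˡ _
    vanish (suc zero)    _ i≢1 = ⊥-elim (i≢1 refl)
    vanish (suc (suc i)) _ _   = zeroˡ _

  D-⊕ : ∀ f g → D (f ⊕ g) ≋ D f ⊕ D g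
  D-⊕ f g = mk≋ λ _ → distribˡ _ _ _

  D-⊖ : ∀ f g → D (f ⊖ g) ≋ D f ⊖ D g
  D-⊖ f g = mk≋ λ _ → solve 3 (λ a b c → a :* (b :- c) := a :* b :- a :* c) refl _ _ _

  D-· : ∀ c f → D (c · f) ≋ c · D f
  D-· c f = mk≋ λ _ → solve 3 (λ a b c → a :* (c :* b) := c :* (a :* b)) refl _ _ _

  D-const : ∀ c → D (const c) ≋ 0ˢ
  D-const c = mk≋ λ _ → zeroʳ _

  D-X : D X ≋ 1ˢ
  D-X = mk≋ λ where
    zero    → trans (*-identityʳ _) fromℕ-1
    (suc n) → zeroʳ _

  D-⊛ : ∀ f g → D (f ⊛ g) ≋ (D f ⊛ g) ⊕ (f ⊛ D g)
  D-⊛ f g = mk≋ λ n → begin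
    fromℕ (suc n) * sumTo (suc n) (λ i → term n i)
      ≡⟨ *-distribˡ-sumTo (suc n) _ _ ⟩
    sumTo (suc n) (λ i → fromℕ (suc n) * term n i)
      ≡⟨ sumTo-cong≤ (suc n) (λ i i≤n → trans (cong (_* term n i) (split (suc n) i i≤n)) (distribʳ _ _ _)) ⟩
    sumTo (suc n) (λ i → fromℕ i * term n i + fromℕ (suc n ℕ.∸ i) * term n i)
      ≡⟨ sumTo-+ (suc n) _ _ ⟩
    sumTo (suc n) (λ i → fromℕ i * term n i) + sumTo (suc n) (λ i → fromℕ (suc n ℕ.∸ i) * term n i)
      ≡⟨ cong₂ _+_ (left n) (right n) ⟩
    ((D f ⊛ g) ⊕ (f ⊛ D g)) n ∎
    where
    term : ℕ → ℕ → Carrier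
    term n i = f i * g (suc n ℕ.∸ i)
    split : ∀ n i → i ≤ₙ n → fromℕ n ≡ fromℕ i + fromℕ (n ℕ.∸ i)
    split n i i≤n = trans (cong fromℕ (sym (ℕP.m+[n∸m]≡n i≤n))) (fromℕ-+ i (n ℕ.∸ i))
    left : ∀ n → sumTo (suc n) (λ i → fromℕ i * term n i) ≡ (D f ⊛ g) n
    left n = begin
      sumTo (suc n) (λ i → fromℕ i * term n i)
        ≡⟨ sumTo-suc n _ ⟩
      0# * term n 0 + sumTo n (λ i → fromℕ (suc i) * (f (suc i) * g (n ℕ.∸ i)))
        ≡⟨ trans (cong₂ _+_ (zeroˡ (term n 0)) refl) (+-identityˡ _) ⟩
      sumTo n (λ i → fromℕ (suc i) * (f (suc i) * g (n ℕ.∸ i)))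
        ≡⟨ sumTo-cong n (λ i → sym (*-assoc _ _ _)) ⟩
      (D f ⊛ g) n ∎
    right : ∀ n → sumTo (suc n) (λ i → fromℕ (suc n ℕ.∸ i) * term n i) ≡ (f ⊛ D g) n
    right n = begin
      sumTo n (λ i → fromℕ (suc n ℕ.∸ i) * term n i) + fromℕ (n ℕ.∸ n) * term n (suc n)
        ≡⟨ cong₂ _+_
             (sumTo-cong≤ n (λ i i≤n → trans
               (cong (λ m → fromℕ m * (f i * g m)) (ℕP.+-∸-assoc 1 i≤n))
               (solve 3 (λ a b c → a :* (b :* c) := b :* (a :* c)) refl _ _ _)))
             (trans (cong (λ m → fromℕ m * term n (suc n)) (ℕP.n∸n≡0 n)) (zeroˡ _)) ⟩
      (f ⊛ D g) n + 0#
        ≡⟨ +-identityʳ _ ⟩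
      (f ⊛ D g) n ∎

  ≋-by-strong-induction : ∀ f g → (∀ n → (∀ k → k <ₙ n → f k ≡ g k) → f n ≡ g n) → f ≋ g
  ≋-by-strong-induction f g step = mk≋ λ n → below (suc n) n ℕP.≤-refl
    where
    below : ∀ m k → k <ₙ m → f k ≡ g k
    below (suc m) k (s≤s k≤m) with ℕP.m≤n⇒m<n∨m≡n k≤m
    ... | inj₁ k<m  = below m k k<m
    ... | inj₂ refl = step k (below k)

  -- Each coefficient of f′ = f h determines the next coefficient of f.
  linear-ode-unique : ∀ f g h → D f ≋ f ⊛ h → D g ≋ g ⊛ h → f 0 ≡ g 0 → f ≋ g
  linear-ode-unique f g h f′≋fh g′≋gh f0≡g0 = ≋-by-strong-induction f g step
    where
    step : ∀ n → (∀ k → k <ₙ n → f k ≡ g k) → f n ≡ g n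
    step zero    _  = f0≡g0
    step (suc n) ih = *-cancelˡ (fromℕ (suc n)) (fromℕ-suc≢0 n) (begin
      D f n          ≡⟨ at f′≋fh n ⟩
      (f ⊛ h) n      ≡⟨ sumTo-cong≤ n (λ i i≤n → cong (_* h (n ℕ.∸ i)) (ih i (s≤s i≤n))) ⟩
      (g ⊛ h) n      ≡⟨ sym (at g′≋gh n) ⟩
      D g n          ∎)

  ^ˢ-vanishes-below : ∀ g → g 0 ≡ 0# → ∀ n k → k <ₙ n → (g ^ˢ n) k ≡ 0#
  ^ˢ-vanishes-below g g0≡0 (suc n) k (s≤s k<n) = sumTo-zero k vanish
    where
    vanish : ∀ i → i ≤ₙ k → g i * (g ^ˢ n) (k ℕ.∸ i) ≡ 0#
    vanish zero    _   = trans (cong (_* (g ^ˢ n) k) g0≡0) (zeroˡ _)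
    vanish (suc i) i<k = trans
      (cong (g (suc i) *_) (^ˢ-vanishes-below g g0≡0 n (k ℕ.∸ suc i)
        (ℕP.<-≤-trans (ℕP.∸-monoʳ-< {k} {suc i} {0} (s≤s z≤n) i<k) k<n)))
      (zeroʳ _)

  ^ˢ-+ : ∀ g a b → g ^ˢ (a ℕ.+ b) ≋ (g ^ˢ a) ⊛ (g ^ˢ b)
  ^ˢ-+ g zero    b = ≋-sym (⊛-identityˡ (g ^ˢ b))
  ^ˢ-+ g (suc a) b = ≋-trans (⊛-congʳ g (^ˢ-+ g a b)) (≋-sym (⊛-assoc g (g ^ˢ a) (g ^ˢ b)))

  ·-^ˢ : ∀ c f n → (c · f) ^ˢ n ≋ (c ^ n) · (f ^ˢ n)
  ·-^ˢ c f zero = mk≋ λ where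
    zero    → sym (*-identityˡ _)
    (suc k) → sym (zeroʳ _)
  ·-^ˢ c f (suc n) =
    (c · f) ⊛ ((c · f) ^ˢ n)          ≋⟨ ⊛-congʳ (c · f) (·-^ˢ c f n) ⟩
    (c · f) ⊛ ((c ^ n) · (f ^ˢ n))    ≋⟨ ⊛-·ˡ c f ((c ^ n) · (f ^ˢ n)) ⟩
    c · (f ⊛ ((c ^ n) · (f ^ˢ n)))    ≋⟨ ·-congʳ c (⊛-·ʳ (c ^ n) f (f ^ˢ n)) ⟩
    c · ((c ^ n) · (f ⊛ (f ^ˢ n)))    ≋⟨ ·-assoc c (c ^ n) (f ⊛ (f ^ˢ n)) ⟩
    (c * (c ^ n)) · (f ⊛ (f ^ˢ n))    ∎ˢ

  D-^ˢ : ∀ g n → D (g ^ˢ suc n) ≋ fromℕ (suc n) · ((g ^ˢ n) ⊛ D g)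
  D-^ˢ g zero =
    D (g ⊛ 1ˢ)                  ≋⟨ D-cong (⊛-identityʳ g) ⟩
    D g                         ≋⟨ mk≋ (λ k → sym (trans (cong (_* (1ˢ ⊛ D g) k) fromℕ-1)
                                     (trans (*-identityˡ _) (at (⊛-identityˡ (D g)) k)))) ⟩
    fromℕ 1 · (1ˢ ⊛ D g)        ∎ˢ
  D-^ˢ g (suc n) =
    D (g ⊛ gⁿ⁺¹)
      ≋⟨ D-⊛ g gⁿ⁺¹ ⟩
    (D g ⊛ gⁿ⁺¹) ⊕ (g ⊛ D gⁿ⁺¹)
      ≋⟨ ⊕-cong (⊛-comm (D g) gⁿ⁺¹) (⊛-congʳ g (D-^ˢ g n)) ⟩
    (gⁿ⁺¹ ⊛ D g) ⊕ (g ⊛ (fromℕ (suc n) · ((g ^ˢ n) ⊛ D g)))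
      ≋⟨ ⊕-cong ≋-refl (≋-trans (⊛-·ʳ (fromℕ (suc n)) g ((g ^ˢ n) ⊛ D g)) (·-congʳ _ (≋-sym (⊛-assoc g (g ^ˢ n) (D g))))) ⟩
    (gⁿ⁺¹ ⊛ D g) ⊕ (fromℕ (suc n) · (gⁿ⁺¹ ⊛ D g))
      ≋⟨ mk≋ (λ k → trans (cong (_+ (fromℕ (suc n) * (gⁿ⁺¹ ⊛ D g) k)) (sym (*-identityˡ _))) (sym (distribʳ _ _ _))) ⟩
    (1# + fromℕ (suc n)) · (gⁿ⁺¹ ⊛ D g) ∎ˢ
    where
    gⁿ⁺¹ = g ^ˢ suc n

  geometricSum : FPS → FPS
  geometricSum b N = sumTo N (λ n → (b ^ˢ n) N)

  -- Truncating Σ bⁿ at N is harmless in degree ≤ N, where it telescopes against 1 - b.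
  ⊛-geometricSum : ∀ b → b 0 ≡ 0# → (1ˢ ⊖ b) ⊛ geometricSum b ≋ 1ˢ
  ⊛-geometricSum b b0≡0 = mk≋ λ N → begin
    sumTo N (λ i → (1ˢ ⊖ b) i * geometricSum b (N ℕ.∸ i))
      ≡⟨ sumTo-cong N (λ i → cong ((1ˢ ⊖ b) i *_) (pad N i)) ⟩
    sumTo N (λ i → (1ˢ ⊖ b) i * sumTo N (λ n → (b ^ˢ n) (N ℕ.∸ i)))
      ≡⟨ trans (sumTo-cong N (λ i → *-distribˡ-sumTo N _ _)) (sumTo-swap N N _) ⟩
    sumTo N (λ n → ((1ˢ ⊖ b) ⊛ (b ^ˢ n)) N)
      ≡⟨ sumTo-cong N (λ n → trans (at (⊛-distribʳ-⊖ (b ^ˢ n) 1ˢ b) N)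
                                   (cong (_- (b ^ˢ suc n) N) (at (⊛-identityˡ (b ^ˢ n)) N))) ⟩
    sumTo N (λ n → (b ^ˢ n) N - (b ^ˢ suc n) N)
      ≡⟨ sumTo-telescope N (λ n → (b ^ˢ n) N) ⟩
    1ˢ N - (b ^ˢ suc N) N
      ≡⟨ cong (λ z → 1ˢ N - z) (^ˢ-vanishes-below b b0≡0 (suc N) N ℕP.≤-refl) ⟩
    1ˢ N - 0#
      ≡⟨ trans (cong (1ˢ N +_) -0#≈0#) (+-identityʳ _) ⟩
    1ˢ N ∎
    where
    pad : ∀ N i → geometricSum b (N ℕ.∸ i) ≡ sumTo N (λ n → (b ^ˢ n) (N ℕ.∸ i))
    pad N i = sym (sumTo-extend (N ℕ.∸ i) N (ℕP.m∸n≤m N i)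
      (λ n i<n _ → ^ˢ-vanishes-below b b0≡0 n (N ℕ.∸ i) i<n))

  ⊛-invˢʳ : ∀ a → ¬ (a 0 ≡ 0#) → a ⊛ invˢ a ≋ 1ˢ
  ⊛-invˢʳ a a0≢0 =
    a ⊛ invˢ a                             ≋⟨ ⊛-congˡ a≋a₀[1-b] (c · geometricSum b) ⟩
    (a 0 · (1ˢ ⊖ b)) ⊛ (c · geometricSum b) ≋⟨ ⊛-·ˡ (a 0) (1ˢ ⊖ b) (c · geometricSum b) ⟩
    a 0 · ((1ˢ ⊖ b) ⊛ (c · geometricSum b)) ≋⟨ ·-congʳ (a 0) (⊛-·ʳ c (1ˢ ⊖ b) (geometricSum b)) ⟩
    a 0 · (c · ((1ˢ ⊖ b) ⊛ geometricSum b)) ≋⟨ ·-congʳ (a 0) (·-congʳ c (⊛-geometricSum b b0≡0)) ⟩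
    a 0 · (c · 1ˢ)                         ≋⟨ ·-assoc (a 0) c 1ˢ ⟩
    (a 0 * c) · 1ˢ                         ≋⟨ ·-congˡ (⁻¹-inverseʳ (a 0) a0≢0) 1ˢ ⟩
    1# · 1ˢ                                ≋⟨ mk≋ (λ _ → *-identityˡ _) ⟩
    1ˢ                                     ∎ˢ
    where
    c = a 0 ⁻¹
    b = 1ˢ ⊖ (c · a)
    b0≡0 : b 0 ≡ 0#
    b0≡0 = trans (cong (λ z → 1# - z) (⁻¹-inverseˡ (a 0) a0≢0)) (-‿inverseʳ 1#)
    a≋a₀[1-b] : a ≋ a 0 · (1ˢ ⊖ b)
    a≋a₀[1-b] = mk≋ λ n → sym (begin
      a 0 * (1ˢ n - (1ˢ n - (c * a n)))   ≡⟨ cong (a 0 *_) (solve 2 (λ k x → k :- (k :- x) := x) refl _ _) ⟩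
      a 0 * (c * a n)                  ≡⟨ sym (*-assoc _ _ _) ⟩
      (a 0 * c) * a n                  ≡⟨ cong (_* a n) (⁻¹-inverseʳ (a 0) a0≢0) ⟩
      1# * a n                         ≡⟨ *-identityˡ _ ⟩
      a n                              ∎)

  ⊛-cancelˡ : ∀ a {f g} → ¬ (a 0 ≡ 0#) → a ⊛ f ≋ a ⊛ g → f ≋ g
  ⊛-cancelˡ a {f} {g} a0≢0 af≋ag =
    f                       ≋⟨ ≋-sym (⊛-identityˡ f) ⟩
    1ˢ ⊛ f                  ≋⟨ ⊛-congˡ (≋-sym a⁻¹a≋1) f ⟩
    (invˢ a ⊛ a) ⊛ f        ≋⟨ ⊛-assoc (invˢ a) a f ⟩
    invˢ a ⊛ (a ⊛ f)        ≋⟨ ⊛-congʳ (invˢ a) af≋ag ⟩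
    invˢ a ⊛ (a ⊛ g)        ≋⟨ ≋-sym (⊛-assoc (invˢ a) a g) ⟩
    (invˢ a ⊛ a) ⊛ g        ≋⟨ ⊛-congˡ a⁻¹a≋1 g ⟩
    1ˢ ⊛ g                  ≋⟨ ⊛-identityˡ g ⟩
    g                       ∎ˢ
    where
    a⁻¹a≋1 : invˢ a ⊛ a ≋ 1ˢ
    a⁻¹a≋1 = ≋-trans (⊛-comm _ _) (⊛-invˢʳ a a0≢0)

  -- Composition

  ∘ˢ-congˡ : ∀ {f f′} → f ≋ f′ → ∀ g → f ∘ˢ g ≋ f′ ∘ˢ g
  ∘ˢ-congˡ p g = mk≋ λ N → sumTo-cong N (λ n → cong (_* (g ^ˢ n) N) (at p n))

  ∘ˢ-congʳ : ∀ f {g g′} → g ≋ g′ → f ∘ˢ g ≋ f ∘ˢ g′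
  ∘ˢ-congʳ f q = mk≋ λ N → sumTo-cong N (λ n → cong (f n *_) (at (^ˢ-cong n q) N))

  ∘ˢ-0 : ∀ f g → (f ∘ˢ g) 0 ≡ f 0
  ∘ˢ-0 f g = *-identityʳ _

  ∘ˢ-extend : ∀ f g → g 0 ≡ 0# → ∀ N M → N ≤ₙ M → (f ∘ˢ g) N ≡ sumTo M (λ n → f n * (g ^ˢ n) N)
  ∘ˢ-extend f g g0≡0 N M N≤M = sym (sumTo-extend N M N≤M
    (λ n N<n _ → trans (cong (f n *_) (^ˢ-vanishes-below g g0≡0 n N N<n)) (zeroʳ _)))

  const-∘ˢ : ∀ c g → const c ∘ˢ g ≋ const c
  const-∘ˢ c g = mk≋ λ N → trans (sumTo-single N 0 z≤n (vanish N)) (c*1ˢ N)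
    where
    vanish : ∀ N i → i ≤ₙ N → ¬ (i ≡ 0) → const c i * (g ^ˢ i) N ≡ 0#
    vanish N zero    _ i≢0 = ⊥-elim (i≢0 refl)
    vanish N (suc i) _ _   = zeroˡ _
    c*1ˢ : ∀ N → c * 1ˢ N ≡ const c N
    c*1ˢ zero    = *-identityʳ c
    c*1ˢ (suc N) = zeroʳ c

  X-∘ˢ : ∀ g → g 0 ≡ 0# → X ∘ˢ g ≋ g
  X-∘ˢ g g0≡0 = mk≋ coefficient
    where
    vanish : ∀ N i → ¬ (i ≡ 1) → X i * (g ^ˢ i) (suc N) ≡ 0#
    vanish N zero          _   = zeroˡ _
    vanish N (suc zero)    i≢1 = ⊥-elim (i≢1 refl)
    vanish N (suc (suc i)) _   = zeroˡ _
    coefficient : ∀ N → (X ∘ˢ g) N ≡ g N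
    coefficient zero    = trans (zeroˡ _) (sym g0≡0)
    coefficient (suc N) = begin
      (X ∘ˢ g) (suc N)       ≡⟨ sumTo-single (suc N) 1 (s≤s z≤n) (λ i _ → vanish N i) ⟩
      1# * (g ⊛ 1ˢ) (suc N)  ≡⟨ *-identityˡ _ ⟩
      (g ⊛ 1ˢ) (suc N)       ≡⟨ at (⊛-identityʳ g) (suc N) ⟩
      g (suc N)              ∎

  D-∘ˢ : ∀ f g → g 0 ≡ 0# → D (f ∘ˢ g) ≋ (D f ∘ˢ g) ⊛ D g
  D-∘ˢ f g g0≡0 = mk≋ λ N → begin
    fromℕ (suc N) * sumTo (suc N) (λ n → f n * (g ^ˢ n) (suc N))
      ≡⟨ trans (*-distribˡ-sumTo (suc N) _ _) (sumTo-cong (suc N) (λ n → *-comm-middle _ _ _)) ⟩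
    sumTo (suc N) (λ n → f n * D (g ^ˢ n) N)
      ≡⟨ sumTo-suc N _ ⟩
    f 0 * D 1ˢ N + sumTo N (λ m → f (suc m) * D (g ^ˢ suc m) N)
      ≡⟨ cong₂ _+_ (trans (cong (f 0 *_) (at (D-const 1#) N)) (zeroʳ _))
                   (sumTo-cong N (λ m → cong (f (suc m) *_) (at (D-^ˢ g m) N))) ⟩
    0# + sumTo N (λ m → f (suc m) * (fromℕ (suc m) * ((g ^ˢ m) ⊛ D g) N))
      ≡⟨ trans (+-identityˡ _) (sumTo-cong N (λ m →
           solve 3 (λ a b c → a :* (b :* c) := (b :* a) :* c) refl _ _ _)) ⟩
    sumTo N (λ m → D f m * ((g ^ˢ m) ⊛ D g) N)
      ≡⟨ sumTo-cong N (λ m → *-distribˡ-sumTo N (D f m) _) ⟩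
    sumTo N (λ m → sumTo N (λ i → D f m * ((g ^ˢ m) i * D g (N ℕ.∸ i))))
      ≡⟨ sumTo-swap N N _ ⟩
    sumTo N (λ i → sumTo N (λ m → D f m * ((g ^ˢ m) i * D g (N ℕ.∸ i))))
      ≡⟨ sumTo-cong≤ N (λ i i≤N → trans (sumTo-cong N (λ m → sym (*-assoc _ _ _)))
           (trans (sym (*-distribʳ-sumTo N _ _))
                  (cong (_* D g (N ℕ.∸ i)) (sym (∘ˢ-extend (D f) g g0≡0 i N i≤N))))) ⟩
    ((D f ∘ˢ g) ⊛ D g) N ∎
    where
    *-comm-middle : ∀ a b c → a * (b * c) ≡ b * (a * c)
    *-comm-middle = solve 3 (λ a b c → a :* (b :* c) := b :* (a :* c)) refl

  ∘ˢ-⊛ : ∀ f h g → g 0 ≡ 0# → (f ⊛ h) ∘ˢ g ≋ (f ∘ˢ g) ⊛ (h ∘ˢ g)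
  ∘ˢ-⊛ f h g g0≡0 = mk≋ λ N → trans (by-degree N) (sym (by-factors N))
    where
    double : ℕ → Carrier
    double N = sumTo N (λ a → sumTo N (λ b → (f a * h b) * ((g ^ˢ a) ⊛ (g ^ˢ b)) N))
    by-degree : ∀ N → ((f ⊛ h) ∘ˢ g) N ≡ double N
    by-degree N = begin
      sumTo N (λ n → sumTo n (λ a → f a * h (n ℕ.∸ a)) * (g ^ˢ n) N)
        ≡⟨ sumTo-cong N (λ n → *-distribʳ-sumTo n _ _) ⟩
      sumTo N (λ n → sumTo n (λ a → f a * h (n ℕ.∸ a) * (g ^ˢ n) N))
        ≡⟨ sumTo-triangle N _ ⟩
      sumTo N (λ a → sumTo (N ℕ.∸ a) (λ b → f a * h (a ℕ.+ b ℕ.∸ a) * (g ^ˢ (a ℕ.+ b)) N))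
        ≡⟨ sumTo-cong N (λ a → sumTo-cong (N ℕ.∸ a) (λ b →
             cong (λ m → f a * h m * (g ^ˢ (a ℕ.+ b)) N) (ℕP.m+n∸m≡n a b))) ⟩
      sumTo N (λ a → sumTo (N ℕ.∸ a) (λ b → f a * h b * (g ^ˢ (a ℕ.+ b)) N))
        ≡⟨ sumTo-cong≤ N (λ a a≤N → sym (sumTo-extend (N ℕ.∸ a) N (ℕP.m∸n≤m N a) (λ b N-a<b _ →
             trans (cong (f a * h b *_) (^ˢ-vanishes-below g g0≡0 (a ℕ.+ b) N (beyond a b a≤N N-a<b)))
                   (zeroʳ _)))) ⟩
      sumTo N (λ a → sumTo N (λ b → f a * h b * (g ^ˢ (a ℕ.+ b)) N))
        ≡⟨ sumTo-cong N (λ a → sumTo-cong N (λ b → cong (f a * h b *_) (at (^ˢ-+ g a b) N))) ⟩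
      double N ∎
      where
      beyond : ∀ a b → a ≤ₙ N → N ℕ.∸ a <ₙ b → N <ₙ a ℕ.+ b
      beyond a b a≤N N-a<b = subst (_<ₙ a ℕ.+ b) (ℕP.m+[n∸m]≡n a≤N) (ℕP.+-monoʳ-< a N-a<b)
    by-factors : ∀ N → ((f ∘ˢ g) ⊛ (h ∘ˢ g)) N ≡ double N
    by-factors N = begin
      sumTo N (λ i → (f ∘ˢ g) i * (h ∘ˢ g) (N ℕ.∸ i))
        ≡⟨ sumTo-cong≤ N (λ i i≤N → cong₂ _*_ (∘ˢ-extend f g g0≡0 i N i≤N)
                                              (∘ˢ-extend h g g0≡0 (N ℕ.∸ i) N (ℕP.m∸n≤m N i))) ⟩
      sumTo N (λ i → sumTo N (λ a → f a * (g ^ˢ a) i) * sumTo N (λ b → h b * (g ^ˢ b) (N ℕ.∸ i)))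
        ≡⟨ sumTo-cong N (λ i → sumTo-*-sumTo N N _ _) ⟩
      sumTo N (λ i → sumTo N (λ a → sumTo N (λ b → (f a * (g ^ˢ a) i) * (h b * (g ^ˢ b) (N ℕ.∸ i)))))
        ≡⟨ trans (sumTo-swap N N _) (sumTo-cong N (λ a → sumTo-swap N N _)) ⟩
      sumTo N (λ a → sumTo N (λ b → sumTo N (λ i → (f a * (g ^ˢ a) i) * (h b * (g ^ˢ b) (N ℕ.∸ i)))))
        ≡⟨ sumTo-cong N (λ a → sumTo-cong N (λ b →
             trans (sumTo-cong N (λ i → *-interchange _ _ _ _)) (sym (*-distribˡ-sumTo N _ _)))) ⟩
      double N ∎

  ^ˢ-∘ˢ : ∀ g h → h 0 ≡ 0# → ∀ m → (g ^ˢ m) ∘ˢ h ≋ (g ∘ˢ h) ^ˢ m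
  ^ˢ-∘ˢ g h h0≡0 zero    = const-∘ˢ 1# h
  ^ˢ-∘ˢ g h h0≡0 (suc m) = ≋-trans (∘ˢ-⊛ g (g ^ˢ m) h h0≡0) (⊛-congʳ (g ∘ˢ h) (^ˢ-∘ˢ g h h0≡0 m))

  ∘ˢ-assoc : ∀ f g h → g 0 ≡ 0# → h 0 ≡ 0# → (f ∘ˢ g) ∘ˢ h ≋ f ∘ˢ (g ∘ˢ h)
  ∘ˢ-assoc f g h g0≡0 h0≡0 = mk≋ λ N → begin
    sumTo N (λ n → (f ∘ˢ g) n * (h ^ˢ n) N)
      ≡⟨ sumTo-cong≤ N (λ n n≤N → cong (_* (h ^ˢ n) N) (∘ˢ-extend f g g0≡0 n N n≤N)) ⟩
    sumTo N (λ n → sumTo N (λ m → f m * (g ^ˢ m) n) * (h ^ˢ n) N)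
      ≡⟨ sumTo-cong N (λ n → trans (*-distribʳ-sumTo N _ _) (sumTo-cong N (λ m → *-assoc _ _ _))) ⟩
    sumTo N (λ n → sumTo N (λ m → f m * ((g ^ˢ m) n * (h ^ˢ n) N)))
      ≡⟨ sumTo-swap N N _ ⟩
    sumTo N (λ m → sumTo N (λ n → f m * ((g ^ˢ m) n * (h ^ˢ n) N)))
      ≡⟨ sumTo-cong N (λ m → sym (*-distribˡ-sumTo N (f m) _)) ⟩
    sumTo N (λ m → f m * ((g ^ˢ m) ∘ˢ h) N)
      ≡⟨ sumTo-cong N (λ m → cong (f m *_) (at (^ˢ-∘ˢ g h h0≡0 m) N)) ⟩
    (f ∘ˢ (g ∘ˢ h)) N ∎

  -- Binomial coefficients and the square root √(x² + 4)

  by-parity : (P : ℕ → Set) → (∀ k → P (k ℕ.* 2)) → (∀ k → P (suc (k ℕ.* 2))) → ∀ n → P n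
  by-parity P even odd zero          = even 0
  by-parity P even odd (suc zero)    = odd 0
  by-parity P even odd (suc (suc n)) =
    by-parity (λ m → P (suc (suc m))) (λ k → even (suc k)) (λ k → odd (suc k)) n

  binom-0 : ∀ s → binom s 0 ≡ 1#
  binom-0 s = trans (*-identityˡ _) fromℕ-1⁻¹

  binom-1 : ∀ s → binom s 1 ≡ s
  binom-1 s = begin
    (1# * (s - 0#)) * fromℕ 1 ⁻¹   ≡⟨ cong₂ _*_ (*-identityˡ _) fromℕ-1⁻¹ ⟩
    (s - 0#) * 1#                  ≡⟨ *-identityʳ _ ⟩
    s + - 0#                       ≡⟨ cong (s +_) -0#≈0# ⟩
    s + 0#                         ≡⟨ +-identityʳ s ⟩
    s                              ∎

  binom-suc : ∀ s m → fromℕ (suc m) * binom s (suc m) ≡ binom s m * (s - fromℕ m)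
  binom-suc s m = begin
    A * ((P * sₘ) * fromℕ (suc m ℕ.* m ℕ.!) ⁻¹)
      ≡⟨ cong (λ z → A * ((P * sₘ) * z)) (trans (cong _⁻¹ (fromℕ-* (suc m) (m ℕ.!)))
                                                (⁻¹-* A B (fromℕ-suc≢0 m) (fromℕ-!≢0 m))) ⟩
    A * ((P * sₘ) * (A ⁻¹ * B ⁻¹))
      ≡⟨ solve 5 (λ a p f a⁻¹ b⁻¹ → a :* ((p :* f) :* (a⁻¹ :* b⁻¹)) := ((a :* a⁻¹) :* (p :* b⁻¹)) :* f)
               refl A P sₘ (A ⁻¹) (B ⁻¹) ⟩
    (A * A ⁻¹) * (P * B ⁻¹) * sₘ
      ≡⟨ cong (λ z → z * (P * B ⁻¹) * sₘ) (⁻¹-inverseʳ A (fromℕ-suc≢0 m)) ⟩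
    1# * (P * B ⁻¹) * sₘ
      ≡⟨ cong (_* sₘ) (*-identityˡ _) ⟩
    binom s m * (s - fromℕ m) ∎
    where
    A = fromℕ (suc m)
    B = fromℕ (m ℕ.!)
    P = prodBelow m (λ i → s - fromℕ i)
    sₘ = s - fromℕ m

  Q √Q : FPS
  Q  = (X ⊛ X) ⊕ const (fromℕ 4)
  √Q = sqrtX²+4

  √Q-even : ∀ k → √Q (k ℕ.* 2) ≡ 2# * (binom ½ k * (¼ ^ k))
  √Q-even k rewrite m*n%n≡0 k 2 ⦃ _ ⦄ | m*n/n≡m k 2 ⦃ _ ⦄ = refl

  √Q-odd : ∀ k → √Q (suc (k ℕ.* 2)) ≡ 0#
  √Q-odd k rewrite [m+kn]%n≡m%n 1 k 2 ⦃ _ ⦄ = refl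

  √Q-0 : √Q 0 ≡ 2#
  √Q-0 = trans (√Q-even 0) (trans (cong (λ b → 2# * (b * 1#)) (binom-0 ½))
                                 (trans (cong (2# *_) (*-identityˡ 1#)) (*-identityʳ 2#)))

  √Q-0≢0 : ¬ (√Q 0 ≡ 0#)
  √Q-0≢0 e = fromℕ-suc≢0 1 (trans (sym √Q-0) e)

  Q-0 : Q 0 ≡ fromℕ 4
  Q-0 = trans (cong (_+ fromℕ 4) (X-⊛-0 X)) (+-identityˡ _)

  Q-⊛ : ∀ f n → (Q ⊛ f) n ≡ fromℕ 4 * f n + (X ⊛ (X ⊛ f)) n
  Q-⊛ f n = begin
    (Q ⊛ f) n                                         ≡⟨ at (⊛-distribʳ-⊕ f (X ⊛ X) (const (fromℕ 4))) n ⟩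
    ((X ⊛ X) ⊛ f) n + (const (fromℕ 4) ⊛ f) n         ≡⟨ cong₂ _+_ (at (⊛-assoc X X f) n) (at (const-⊛ (fromℕ 4) f) n) ⟩
    (X ⊛ (X ⊛ f)) n + fromℕ 4 * f n                   ≡⟨ +-comm _ _ ⟩
    fromℕ 4 * f n + (X ⊛ (X ⊛ f)) n                   ∎

  X-⊛-X-⊛-1 : ∀ f → (X ⊛ (X ⊛ f)) 1 ≡ 0#
  X-⊛-X-⊛-1 f = trans (X-⊛-suc (X ⊛ f) 0) (X-⊛-0 f)

  X-⊛-X-⊛-suc-suc : ∀ f m → (X ⊛ (X ⊛ f)) (suc (suc m)) ≡ f m
  X-⊛-X-⊛-suc-suc f m = trans (X-⊛-suc (X ⊛ f) (suc m)) (X-⊛-suc f m)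

  -- With √Q(2k) = 2 binom(½,k) ¼ᵏ this is (k+1) binom(½,k+1) = binom(½,k) (½ - k).
  √Q-recurrence : ∀ k →
    fromℕ 4 * D √Q (suc (k ℕ.* 2)) + fromℕ (k ℕ.* 2) * √Q (k ℕ.* 2) ≡ √Q (k ℕ.* 2)
  √Q-recurrence k = begin
    fromℕ 4 * (fromℕ (suc (suc (k ℕ.* 2))) * √Q (suc k ℕ.* 2)) + fromℕ (k ℕ.* 2) * √Q (k ℕ.* 2)
      ≡⟨ cong₂ (λ a b → fromℕ 4 * (fromℕ (suc (suc (k ℕ.* 2))) * a) + fromℕ (k ℕ.* 2) * b)
               (√Q-even (suc k)) (√Q-even k) ⟩
    fromℕ 4 * (fromℕ (2 ℕ.+ k ℕ.* 2) * (2# * (Bₖ₊₁ * (¼ * ¼ᵏ)))) + fromℕ (k ℕ.* 2) * (2# * (Bₖ * ¼ᵏ))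
      ≡⟨ cong₂ (λ a b → fromℕ 4 * (a * (2# * (Bₖ₊₁ * (¼ * ¼ᵏ)))) + b * (2# * (Bₖ * ¼ᵏ)))
               (trans (fromℕ-+ 2 (k ℕ.* 2)) (cong (fromℕ 2 +_) (fromℕ-* k 2))) (fromℕ-* k 2) ⟩
    fromℕ 4 * ((fromℕ 2 + K * 2#) * (2# * (Bₖ₊₁ * (¼ * ¼ᵏ)))) + (K * 2#) * (2# * (Bₖ * ¼ᵏ))
      ≡⟨ solve 6 (λ K B′ B q Q h → con (ℤ.+ 4) :* ((con (ℤ.+ 2) :+ K :* con (ℤ.+ 2)) :* (con (ℤ.+ 2) :* (B′ :* (q :* Q))))
                                    :+ (K :* con (ℤ.+ 2)) :* (con (ℤ.+ 2) :* (B :* Q))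
                               := con (ℤ.+ 4) :* (con (ℤ.+ 4) :* q) :* ((con (ℤ.+ 1) :+ K) :* B′) :* Q
                                    :+ con (ℤ.+ 4) :* K :* B :* Q)
               refl K Bₖ₊₁ Bₖ ¼ ¼ᵏ ½ ⟩
    fromℕ 4 * (fromℕ 4 * ¼) * ((fromℕ 1 + K) * Bₖ₊₁) * ¼ᵏ + fromℕ 4 * K * Bₖ * ¼ᵏ
      ≡⟨ cong₂ (λ a b → fromℕ 4 * a * b * ¼ᵏ + fromℕ 4 * K * Bₖ * ¼ᵏ)
               (trans (⁻¹-inverseʳ (fromℕ 4) (fromℕ-suc≢0 3)) (sym fromℕ-1))
               (trans (cong (_* Bₖ₊₁) (sym (fromℕ-+ 1 k))) (binom-suc ½ k)) ⟩
    fromℕ 4 * fromℕ 1 * (Bₖ * (½ - K)) * ¼ᵏ + fromℕ 4 * K * Bₖ * ¼ᵏ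
      ≡⟨ solve 4 (λ K B Q h → con (ℤ.+ 4) :* con (ℤ.+ 1) :* (B :* (h :- K)) :* Q :+ con (ℤ.+ 4) :* K :* B :* Q
                            := con (ℤ.+ 2) :* (con (ℤ.+ 2) :* h) :* (B :* Q))
               refl K Bₖ ¼ᵏ ½ ⟩
    2# * (2# * ½) * (Bₖ * ¼ᵏ)
      ≡⟨ cong (λ z → 2# * z * (Bₖ * ¼ᵏ)) (trans 2*½≡1 fromℕ-1) ⟩
    2# * 1# * (Bₖ * ¼ᵏ)
      ≡⟨ cong (_* (Bₖ * ¼ᵏ)) (*-identityʳ 2#) ⟩
    2# * (Bₖ * ¼ᵏ)
      ≡⟨ sym (√Q-even k) ⟩
    √Q (k ℕ.* 2) ∎
    where
    K    = fromℕ k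
    Bₖ   = binom ½ k
    Bₖ₊₁ = binom ½ (suc k)
    ¼ᵏ   = ¼ ^ k

  Q⊛D√Q≋X⊛√Q : Q ⊛ D √Q ≋ X ⊛ √Q
  Q⊛D√Q≋X⊛√Q = mk≋ λ n → trans (Q-⊛ (D √Q) n) (by-parity (λ n → coefficient n) even odd n)
    where
    coefficient : ℕ → Set
    coefficient n = fromℕ 4 * D √Q n + (X ⊛ (X ⊛ D √Q)) n ≡ (X ⊛ √Q) n
    D√Q-even : ∀ k → D √Q (k ℕ.* 2) ≡ 0#
    D√Q-even k = trans (cong (fromℕ (suc (k ℕ.* 2)) *_) (√Q-odd k)) (zeroʳ _)
    X⊛X⊛D√Q-even : ∀ k → (X ⊛ (X ⊛ D √Q)) (k ℕ.* 2) ≡ 0#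
    X⊛X⊛D√Q-even zero    = X-⊛-0 (X ⊛ D √Q)
    X⊛X⊛D√Q-even (suc k) = trans (X-⊛-X-⊛-suc-suc (D √Q) (k ℕ.* 2)) (D√Q-even k)
    X⊛√Q-even : ∀ k → (X ⊛ √Q) (k ℕ.* 2) ≡ 0#
    X⊛√Q-even zero    = X-⊛-0 √Q
    X⊛√Q-even (suc k) = trans (X-⊛-suc √Q (suc (k ℕ.* 2))) (√Q-odd k)
    X⊛X⊛D√Q-odd : ∀ k → (X ⊛ (X ⊛ D √Q)) (suc (k ℕ.* 2)) ≡ fromℕ (k ℕ.* 2) * √Q (k ℕ.* 2)
    X⊛X⊛D√Q-odd zero    = trans (X-⊛-X-⊛-1 (D √Q)) (sym (zeroˡ _))
    X⊛X⊛D√Q-odd (suc k) = X-⊛-X-⊛-suc-suc (D √Q) (suc (k ℕ.* 2))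
    even : ∀ k → coefficient (k ℕ.* 2)
    even k = begin
      fromℕ 4 * D √Q (k ℕ.* 2) + (X ⊛ (X ⊛ D √Q)) (k ℕ.* 2)
        ≡⟨ cong₂ (λ a b → fromℕ 4 * a + b) (D√Q-even k) (X⊛X⊛D√Q-even k) ⟩
      fromℕ 4 * 0# + 0#    ≡⟨ trans (+-identityʳ _) (zeroʳ _) ⟩
      0#                   ≡⟨ sym (X⊛√Q-even k) ⟩
      (X ⊛ √Q) (k ℕ.* 2)   ∎
    odd : ∀ k → coefficient (suc (k ℕ.* 2))
    odd k = begin
      fromℕ 4 * D √Q (suc (k ℕ.* 2)) + (X ⊛ (X ⊛ D √Q)) (suc (k ℕ.* 2))
        ≡⟨ cong (fromℕ 4 * D √Q (suc (k ℕ.* 2)) +_) (X⊛X⊛D√Q-odd k) ⟩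
      fromℕ 4 * D √Q (suc (k ℕ.* 2)) + fromℕ (k ℕ.* 2) * √Q (k ℕ.* 2)
        ≡⟨ √Q-recurrence k ⟩
      √Q (k ℕ.* 2)                  ≡⟨ sym (X-⊛-suc √Q (k ℕ.* 2)) ⟩
      (X ⊛ √Q) (suc (k ℕ.* 2))      ∎

  Q-ode-unique : ∀ f g → Q ⊛ D f ≋ 2# · (X ⊛ f) → Q ⊛ D g ≋ 2# · (X ⊛ g) → f 0 ≡ g 0 → f ≋ g
  Q-ode-unique f g Qf′≋2xf Qg′≋2xg = linear-ode-unique f g h (normalise f Qf′≋2xf) (normalise g Qg′≋2xg)
    where
    Q-0≢0 : ¬ (Q 0 ≡ 0#)
    Q-0≢0 e = fromℕ-suc≢0 3 (trans (sym Q-0) e)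
    h : FPS
    h = (2# · X) ⊛ invˢ Q
    Q⊛f⊛h : ∀ f → Q ⊛ (f ⊛ h) ≋ 2# · (X ⊛ f)
    Q⊛f⊛h f =
      Q ⊛ (f ⊛ ((2# · X) ⊛ invˢ Q))    ≋⟨ ⊛-congʳ Q (≋-sym (⊛-assoc f (2# · X) (invˢ Q))) ⟩
      Q ⊛ ((f ⊛ (2# · X)) ⊛ invˢ Q)    ≋⟨ ⊛-congʳ Q (⊛-comm (f ⊛ (2# · X)) (invˢ Q)) ⟩
      Q ⊛ (invˢ Q ⊛ (f ⊛ (2# · X)))    ≋⟨ ≋-sym (⊛-assoc Q (invˢ Q) (f ⊛ (2# · X))) ⟩
      (Q ⊛ invˢ Q) ⊛ (f ⊛ (2# · X))    ≋⟨ ⊛-congˡ (⊛-invˢʳ Q Q-0≢0) (f ⊛ (2# · X)) ⟩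
      1ˢ ⊛ (f ⊛ (2# · X))              ≋⟨ ⊛-identityˡ (f ⊛ (2# · X)) ⟩
      f ⊛ (2# · X)                     ≋⟨ ⊛-·ʳ 2# f X ⟩
      2# · (f ⊛ X)                     ≋⟨ ·-congʳ 2# (⊛-comm f X) ⟩
      2# · (X ⊛ f)                     ∎ˢ
    normalise : ∀ f → Q ⊛ D f ≋ 2# · (X ⊛ f) → D f ≋ f ⊛ h
    normalise f Qf′≋2xf = ⊛-cancelˡ Q Q-0≢0 (≋-trans Qf′≋2xf (≋-sym (Q⊛f⊛h f)))

  ⊕-self : ∀ f → f ⊕ f ≋ 2# · f
  ⊕-self f = mk≋ λ n → solve 1 (λ x → x :+ x := con (ℤ.+ 2) :* x) refl (f n)

  -- Both sides solve Q f′ = 2 x f and have constant term 4.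
  √Q⊛√Q≋Q : √Q ⊛ √Q ≋ Q
  √Q⊛√Q≋Q = Q-ode-unique (√Q ⊛ √Q) Q Q⊛D[√Q⊛√Q] Q⊛DQ
    (trans (cong₂ _*_ √Q-0 √Q-0) (trans (solve 0 (con (ℤ.+ 2) :* con (ℤ.+ 2) := con (ℤ.+ 4)) refl) (sym Q-0)))
    where
    Q⊛D[√Q⊛√Q] : Q ⊛ D (√Q ⊛ √Q) ≋ 2# · (X ⊛ (√Q ⊛ √Q))
    Q⊛D[√Q⊛√Q] =
      Q ⊛ D (√Q ⊛ √Q)                   ≋⟨ ⊛-congʳ Q (D-⊛ √Q √Q) ⟩
      Q ⊛ ((D √Q ⊛ √Q) ⊕ (√Q ⊛ D √Q))   ≋⟨ ⊛-congʳ Q (⊕-cong (⊛-comm (D √Q) √Q) (≋-refl {√Q ⊛ D √Q})) ⟩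
      Q ⊛ ((√Q ⊛ D √Q) ⊕ (√Q ⊛ D √Q))   ≋⟨ ⊛-congʳ Q (⊕-self (√Q ⊛ D √Q)) ⟩
      Q ⊛ (2# · (√Q ⊛ D √Q))            ≋⟨ ⊛-·ʳ 2# Q (√Q ⊛ D √Q) ⟩
      2# · (Q ⊛ (√Q ⊛ D √Q))            ≋⟨ ·-congʳ 2# (≋-sym (⊛-assoc Q √Q (D √Q))) ⟩
      2# · ((Q ⊛ √Q) ⊛ D √Q)            ≋⟨ ·-congʳ 2# (⊛-congˡ (⊛-comm Q √Q) (D √Q)) ⟩
      2# · ((√Q ⊛ Q) ⊛ D √Q)            ≋⟨ ·-congʳ 2# (⊛-assoc √Q Q (D √Q)) ⟩
      2# · (√Q ⊛ (Q ⊛ D √Q))            ≋⟨ ·-congʳ 2# (⊛-congʳ √Q Q⊛D√Q≋X⊛√Q) ⟩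
      2# · (√Q ⊛ (X ⊛ √Q))              ≋⟨ ·-congʳ 2# (≋-sym (⊛-assoc √Q X √Q)) ⟩
      2# · ((√Q ⊛ X) ⊛ √Q)              ≋⟨ ·-congʳ 2# (⊛-congˡ (⊛-comm √Q X) √Q) ⟩
      2# · ((X ⊛ √Q) ⊛ √Q)              ≋⟨ ·-congʳ 2# (⊛-assoc X √Q √Q) ⟩
      2# · (X ⊛ (√Q ⊛ √Q))              ∎ˢ
    DQ : D Q ≋ 2# · X
    DQ =
      D Q                                      ≋⟨ ≋-trans (D-⊕ (X ⊛ X) (const (fromℕ 4))) (⊕-cong (D-⊛ X X) (D-const (fromℕ 4))) ⟩
      ((D X ⊛ X) ⊕ (X ⊛ D X)) ⊕ 0ˢ             ≋⟨ ⊕-cong (⊕-cong (⊛-congˡ D-X X) (⊛-congʳ X D-X)) (≋-refl {0ˢ}) ⟩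
      ((1ˢ ⊛ X) ⊕ (X ⊛ 1ˢ)) ⊕ 0ˢ               ≋⟨ ⊕-cong (⊕-cong (⊛-identityˡ X) (⊛-identityʳ X)) (≋-refl {0ˢ}) ⟩
      (X ⊕ X) ⊕ 0ˢ                             ≋⟨ ≋-trans (mk≋ λ _ → +-identityʳ _) (⊕-self X) ⟩
      2# · X                                   ∎ˢ
    Q⊛DQ : Q ⊛ D Q ≋ 2# · (X ⊛ Q)
    Q⊛DQ = ≋-trans (⊛-congʳ Q DQ) (≋-trans (⊛-·ʳ 2# Q X) (·-congʳ 2# (⊛-comm Q X)))

  √Q⊛D√Q≋X : √Q ⊛ D √Q ≋ X
  √Q⊛D√Q≋X = ⊛-cancelˡ √Q √Q-0≢0 (
    √Q ⊛ (√Q ⊛ D √Q)    ≋⟨ ≋-sym (⊛-assoc √Q √Q (D √Q)) ⟩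
    (√Q ⊛ √Q) ⊛ D √Q    ≋⟨ ⊛-congˡ √Q⊛√Q≋Q (D √Q) ⟩
    Q ⊛ D √Q            ≋⟨ Q⊛D√Q≋X⊛√Q ⟩
    X ⊛ √Q              ≋⟨ ⊛-comm X √Q ⟩
    √Q ⊛ X              ∎ˢ)

  -- The logarithm of α

  α-0 : α 0 ≡ 1#
  α-0 = begin
    ½ * (0# + √Q 0)   ≡⟨ cong (λ z → ½ * z) (trans (+-identityˡ _) √Q-0) ⟩
    ½ * 2#            ≡⟨ *-comm ½ 2# ⟩
    2# * ½            ≡⟨ trans 2*½≡1 fromℕ-1 ⟩
    1#                ∎

  α-0≢0 : ¬ (α 0 ≡ 0#)
  α-0≢0 e = 0≢1 (trans (sym e) α-0)

  logα : FPS
  logα = logˢ α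

  logα-0 : logα 0 ≡ 0#
  logα-0 = ∘ˢ-0 log1pSeries (α ⊖ 1ˢ)

  α-1-0 : (α ⊖ 1ˢ) 0 ≡ 0#
  α-1-0 = trans (cong (_- 1#) α-0) (-‿inverseʳ 1#)

  D-expSeries : D expSeries ≋ expSeries
  D-expSeries = mk≋ λ n → begin
    fromℕ (suc n) * fromℕ (suc n ℕ.* n ℕ.!) ⁻¹
      ≡⟨ cong (λ z → fromℕ (suc n) * z ⁻¹) (fromℕ-* (suc n) (n ℕ.!)) ⟩
    fromℕ (suc n) * (fromℕ (suc n) * fromℕ (n ℕ.!)) ⁻¹
      ≡⟨ cong (fromℕ (suc n) *_) (⁻¹-* _ _ (fromℕ-suc≢0 n) (fromℕ-!≢0 n)) ⟩
    fromℕ (suc n) * (fromℕ (suc n) ⁻¹ * fromℕ (n ℕ.!) ⁻¹)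
      ≡⟨ sym (*-assoc _ _ _) ⟩
    (fromℕ (suc n) * fromℕ (suc n) ⁻¹) * fromℕ (n ℕ.!) ⁻¹
      ≡⟨ cong (_* fromℕ (n ℕ.!) ⁻¹) (⁻¹-inverseʳ _ (fromℕ-suc≢0 n)) ⟩
    1# * fromℕ (n ℕ.!) ⁻¹
      ≡⟨ *-identityˡ _ ⟩
    expSeries n ∎

  alternating : FPS
  alternating n = (- 1#) ^ n

  D-log1pSeries : D log1pSeries ≋ alternating
  D-log1pSeries = mk≋ λ n → begin
    fromℕ (suc n) * ((- 1#) ^ n * fromℕ (suc n) ⁻¹)
      ≡⟨ solve 3 (λ a b c → a :* (b :* c) := b :* (a :* c)) refl _ _ _ ⟩
    (- 1#) ^ n * (fromℕ (suc n) * fromℕ (suc n) ⁻¹)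
      ≡⟨ cong ((- 1#) ^ n *_) (⁻¹-inverseʳ _ (fromℕ-suc≢0 n)) ⟩
    (- 1#) ^ n * 1#
      ≡⟨ *-identityʳ _ ⟩
    alternating n ∎

  -- alternating ∘ˢ (α - 1) is the geometric series Σ (1 - α)ⁿ, i.e. 1/α.
  α⊛alternating∘ˢ[α-1] : α ⊛ (alternating ∘ˢ (α ⊖ 1ˢ)) ≋ 1ˢ
  α⊛alternating∘ˢ[α-1] =
    α ⊛ (alternating ∘ˢ (α ⊖ 1ˢ))   ≋⟨ ⊛-cong α≋1-b (mk≋ λ N → sumTo-cong N (λ n → sym (at (·-^ˢ (- 1#) (α ⊖ 1ˢ) n) N))) ⟩
    (1ˢ ⊖ b) ⊛ geometricSum b       ≋⟨ ⊛-geometricSum b (trans (cong ((- 1#) *_) α-1-0) (zeroʳ _)) ⟩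
    1ˢ                              ∎ˢ
    where
    b = (- 1#) · (α ⊖ 1ˢ)
    α≋1-b : α ≋ 1ˢ ⊖ b
    α≋1-b = mk≋ λ n → sym (trans (cong (λ z → 1ˢ n - z) (-1*x≈-x _))
      (solve 2 (λ k a → k :- (:- (a :- k)) := a) refl (1ˢ n) (α n)))

  α⊛D-logα : α ⊛ D logα ≋ D α
  α⊛D-logα =
    α ⊛ D logα                                   ≋⟨ ⊛-congʳ α (D-∘ˢ log1pSeries (α ⊖ 1ˢ) α-1-0) ⟩
    α ⊛ ((D log1pSeries ∘ˢ (α ⊖ 1ˢ)) ⊛ D (α ⊖ 1ˢ))  ≋⟨ ⊛-congʳ α (⊛-cong (∘ˢ-congˡ D-log1pSeries (α ⊖ 1ˢ)) D[α-1]) ⟩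
    α ⊛ ((alternating ∘ˢ (α ⊖ 1ˢ)) ⊛ D α)        ≋⟨ ≋-sym (⊛-assoc α (alternating ∘ˢ (α ⊖ 1ˢ)) (D α)) ⟩
    (α ⊛ (alternating ∘ˢ (α ⊖ 1ˢ))) ⊛ D α        ≋⟨ ⊛-congˡ α⊛alternating∘ˢ[α-1] (D α) ⟩
    1ˢ ⊛ D α                                     ≋⟨ ⊛-identityˡ (D α) ⟩
    D α                                          ∎ˢ
    where
    D[α-1] : D (α ⊖ 1ˢ) ≋ D α
    D[α-1] = ≋-trans (D-⊖ α 1ˢ) (mk≋ λ n →
      trans (cong (λ z → D α n - z) (at (D-const 1#) n)) (trans (cong (D α n +_) -0#≈0#) (+-identityʳ _)))

  √Q⊛Dα≋α : √Q ⊛ D α ≋ α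
  √Q⊛Dα≋α =
    √Q ⊛ D α                          ≋⟨ ⊛-congʳ √Q (≋-trans (D-· ½ (X ⊕ √Q)) (·-congʳ ½ (≋-trans (D-⊕ X √Q) (⊕-cong D-X (≋-refl {D √Q}))))) ⟩
    √Q ⊛ (½ · (1ˢ ⊕ D √Q))            ≋⟨ ⊛-·ʳ ½ √Q (1ˢ ⊕ D √Q) ⟩
    ½ · (√Q ⊛ (1ˢ ⊕ D √Q))            ≋⟨ ·-congʳ ½ (⊛-distribˡ-⊕ √Q 1ˢ (D √Q)) ⟩
    ½ · ((√Q ⊛ 1ˢ) ⊕ (√Q ⊛ D √Q))     ≋⟨ ·-congʳ ½ (⊕-cong (⊛-identityʳ √Q) √Q⊛D√Q≋X) ⟩
    ½ · (√Q ⊕ X)                      ≋⟨ ·-congʳ ½ (mk≋ λ _ → +-comm _ _) ⟩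
    α                                 ∎ˢ

  √Q⊛D-logα≋1 : √Q ⊛ D logα ≋ 1ˢ
  √Q⊛D-logα≋1 = ⊛-cancelˡ α α-0≢0 (
    α ⊛ (√Q ⊛ D logα)     ≋⟨ ≋-sym (⊛-assoc α √Q (D logα)) ⟩
    (α ⊛ √Q) ⊛ D logα     ≋⟨ ⊛-congˡ (⊛-comm α √Q) (D logα) ⟩
    (√Q ⊛ α) ⊛ D logα     ≋⟨ ⊛-assoc √Q α (D logα) ⟩
    √Q ⊛ (α ⊛ D logα)     ≋⟨ ⊛-congʳ √Q α⊛D-logα ⟩
    √Q ⊛ D α              ≋⟨ √Q⊛Dα≋α ⟩
    α                     ≋⟨ ≋-sym (⊛-identityʳ α) ⟩
    α ⊛ 1ˢ                ∎ˢ)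

  α^-0 : ∀ t → α^ t 0 ≡ 1#
  α^-0 t = trans (∘ˢ-0 expSeries (t · logα)) fromℕ-1⁻¹

  t·logα-0 : ∀ t → (t · logα) 0 ≡ 0#
  t·logα-0 t = trans (cong (t *_) logα-0) (zeroʳ t)

  D-expˢ : ∀ g → g 0 ≡ 0# → D (expˢ g) ≋ expˢ g ⊛ D g
  D-expˢ g g0≡0 = ≋-trans (D-∘ˢ expSeries g g0≡0) (⊛-congˡ (∘ˢ-congˡ D-expSeries g) (D g))

  √Q⊛D-α^ : ∀ t → √Q ⊛ D (α^ t) ≋ t · α^ t
  √Q⊛D-α^ t =
    √Q ⊛ D (α^ t)                  ≋⟨ ⊛-congʳ √Q (≋-trans (D-expˢ (t · logα) (t·logα-0 t)) (⊛-congʳ (α^ t) (D-· t logα))) ⟩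
    √Q ⊛ (α^ t ⊛ (t · D logα))     ≋⟨ ⊛-congʳ √Q (⊛-·ʳ t (α^ t) (D logα)) ⟩
    √Q ⊛ (t · (α^ t ⊛ D logα))     ≋⟨ ⊛-·ʳ t √Q (α^ t ⊛ D logα) ⟩
    t · (√Q ⊛ (α^ t ⊛ D logα))     ≋⟨ ·-congʳ t (≋-sym (⊛-assoc √Q (α^ t) (D logα))) ⟩
    t · ((√Q ⊛ α^ t) ⊛ D logα)     ≋⟨ ·-congʳ t (⊛-congˡ (⊛-comm √Q (α^ t)) (D logα)) ⟩
    t · ((α^ t ⊛ √Q) ⊛ D logα)     ≋⟨ ·-congʳ t (⊛-assoc (α^ t) √Q (D logα)) ⟩
    t · (α^ t ⊛ (√Q ⊛ D logα))     ≋⟨ ·-congʳ t (⊛-congʳ (α^ t) √Q⊛D-logα≋1) ⟩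
    t · (α^ t ⊛ 1ˢ)                ≋⟨ ·-congʳ t (⊛-identityʳ (α^ t)) ⟩
    t · α^ t                       ∎ˢ

  -- A recurrence characterising Φ₀

  -- Coefficientwise form of the ODE (x f + (x² + 4) f′)′ = t² f.
  Recurrence : Carrier → FPS → ℕ → Set
  Recurrence t f m =
    fromℕ (suc m) * (fromℕ (suc m) * f m + fromℕ 4 * (fromℕ (suc (suc m)) * f (suc (suc m))))
      ≡ (t * t) * f m

  ode⇒recurrence : ∀ t f → D ((X ⊛ f) ⊕ (Q ⊛ D f)) ≋ (t * t) · f → ∀ m → Recurrence t f m
  ode⇒recurrence t f ode m = begin
    M * ((1# + fromℕ m) * f m + C)
      ≡⟨ cong (λ z → M * (z + C)) (trans (distribʳ _ _ _) (cong (_+ fromℕ m * f m) (*-identityˡ _))) ⟩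
    M * ((f m + fromℕ m * f m) + C)
      ≡⟨ cong (M *_) (solve 3 (λ a b c → (a :+ b) :+ c := a :+ (c :+ b)) refl (f m) (fromℕ m * f m) C) ⟩
    M * (f m + (C + fromℕ m * f m))
      ≡⟨ cong (λ z → M * (f m + (C + z))) (sym (X-⊛-X-⊛-D m)) ⟩
    M * (f m + (fromℕ 4 * D f (suc m) + (X ⊛ (X ⊛ D f)) (suc m)))
      ≡⟨ cong (λ z → M * (z + (fromℕ 4 * D f (suc m) + (X ⊛ (X ⊛ D f)) (suc m)))) (sym (X-⊛-suc f m)) ⟩
    M * ((X ⊛ f) (suc m) + (fromℕ 4 * D f (suc m) + (X ⊛ (X ⊛ D f)) (suc m)))
      ≡⟨ cong (λ z → M * ((X ⊛ f) (suc m) + z)) (sym (Q-⊛ (D f) (suc m))) ⟩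
    D ((X ⊛ f) ⊕ (Q ⊛ D f)) m
      ≡⟨ at ode m ⟩
    (t * t) * f m ∎
    where
    M = fromℕ (suc m)
    C = fromℕ 4 * (fromℕ (suc (suc m)) * f (suc (suc m)))
    X-⊛-X-⊛-D : ∀ n → (X ⊛ (X ⊛ D f)) (suc n) ≡ fromℕ n * f n
    X-⊛-X-⊛-D zero    = trans (X-⊛-X-⊛-1 (D f)) (sym (zeroˡ _))
    X-⊛-X-⊛-D (suc n) = X-⊛-X-⊛-suc-suc (D f) n

  -- The recurrence determines f (n + 2) from f n, since n + 1 and n + 2 are invertible.
  recurrence-unique : ∀ t f g → f 0 ≡ g 0 → f 1 ≡ g 1 →
    (∀ m → Recurrence t f m) → (∀ m → Recurrence t g m) → f ≋ g
  recurrence-unique t f g f0≡g0 f1≡g1 rec-f rec-g = ≋-by-strong-induction f g step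
    where
    open import Algebra.Properties.Group (CommutativeRing.+-group commutativeRing)
      using () renaming (∙-cancelˡ to +-cancelˡ)
    step : ∀ n → (∀ k → k <ₙ n → f k ≡ g k) → f n ≡ g n
    step zero          _  = f0≡g0
    step (suc zero)    _  = f1≡g1
    step (suc (suc m)) ih =
      *-cancelˡ B (fromℕ-suc≢0 (suc m)) (*-cancelˡ (fromℕ 4) (fromℕ-suc≢0 3)
        (+-cancelˡ (A * g m) _ _ (*-cancelˡ A (fromℕ-suc≢0 m) (begin
          A * (A * g m + fromℕ 4 * (B * f (suc (suc m))))  ≡⟨ cong (λ z → A * (A * z + fromℕ 4 * (B * f (suc (suc m))))) (sym fm≡gm) ⟩
          A * (A * f m + fromℕ 4 * (B * f (suc (suc m))))  ≡⟨ rec-f m ⟩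
          (t * t) * f m                                    ≡⟨ cong ((t * t) *_) fm≡gm ⟩
          (t * t) * g m                                    ≡⟨ sym (rec-g m) ⟩
          A * (A * g m + fromℕ 4 * (B * g (suc (suc m))))  ∎))))
      where
      A = fromℕ (suc m)
      B = fromℕ (suc (suc m))
      fm≡gm : f m ≡ g m
      fm≡gm = ih m (ℕP.≤-trans (ℕP.n≤1+n (suc m)) ℕP.≤-refl)

  module _ (t : Carrier) where

    twoSinh twoCosh Ψ : FPS
    twoSinh = α^ t ⊖ α^ (- t)
    twoCosh = α^ t ⊕ α^ (- t)
    Ψ       = twoSinh ⊛ invˢ √Q

    √Q⊛D-twoSinh : √Q ⊛ D twoSinh ≋ t · twoCosh
    √Q⊛D-twoSinh =
      √Q ⊛ D twoSinh                            ≋⟨ ⊛-congʳ √Q (D-⊖ (α^ t) (α^ (- t))) ⟩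
      √Q ⊛ (D (α^ t) ⊖ D (α^ (- t)))            ≋⟨ ⊛-distribˡ-⊖ √Q (D (α^ t)) (D (α^ (- t))) ⟩
      (√Q ⊛ D (α^ t)) ⊖ (√Q ⊛ D (α^ (- t)))     ≋⟨ ⊖-cong (√Q⊛D-α^ t) (√Q⊛D-α^ (- t)) ⟩
      (t · α^ t) ⊖ ((- t) · α^ (- t))           ≋⟨ mk≋ (λ n → solve 3 (λ t a b → t :* a :- (:- t) :* b := t :* (a :+ b)) refl t _ _) ⟩
      t · twoCosh                               ∎ˢ

    √Q⊛D-twoCosh : √Q ⊛ D twoCosh ≋ t · twoSinh
    √Q⊛D-twoCosh =
      √Q ⊛ D twoCosh                            ≋⟨ ⊛-congʳ √Q (D-⊕ (α^ t) (α^ (- t))) ⟩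
      √Q ⊛ (D (α^ t) ⊕ D (α^ (- t)))            ≋⟨ ⊛-distribˡ-⊕ √Q (D (α^ t)) (D (α^ (- t))) ⟩
      (√Q ⊛ D (α^ t)) ⊕ (√Q ⊛ D (α^ (- t)))     ≋⟨ ⊕-cong (√Q⊛D-α^ t) (√Q⊛D-α^ (- t)) ⟩
      (t · α^ t) ⊕ ((- t) · α^ (- t))           ≋⟨ mk≋ (λ n → solve 3 (λ t a b → t :* a :+ (:- t) :* b := t :* (a :- b)) refl t _ _) ⟩
      t · twoSinh                               ∎ˢ

    √Q⊛Ψ≋twoSinh : √Q ⊛ Ψ ≋ twoSinh
    √Q⊛Ψ≋twoSinh =
      √Q ⊛ (twoSinh ⊛ invˢ √Q)    ≋⟨ ⊛-congʳ √Q (⊛-comm twoSinh (invˢ √Q)) ⟩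
      √Q ⊛ (invˢ √Q ⊛ twoSinh)    ≋⟨ ≋-sym (⊛-assoc √Q (invˢ √Q) twoSinh) ⟩
      (√Q ⊛ invˢ √Q) ⊛ twoSinh    ≋⟨ ⊛-congˡ (⊛-invˢʳ √Q √Q-0≢0) twoSinh ⟩
      1ˢ ⊛ twoSinh                ≋⟨ ⊛-identityˡ twoSinh ⟩
      twoSinh                     ∎ˢ

    -- √Q (√Q Ψ)′ = x Ψ + Q Ψ′, because √Q √Q′ = x and √Q² = Q.
    √Q⊛D-twoSinh≋xΨ+QΨ′ : √Q ⊛ D twoSinh ≋ (X ⊛ Ψ) ⊕ (Q ⊛ D Ψ)
    √Q⊛D-twoSinh≋xΨ+QΨ′ =
      √Q ⊛ D twoSinh                                 ≋⟨ ⊛-congʳ √Q (D-cong (≋-sym √Q⊛Ψ≋twoSinh)) ⟩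
      √Q ⊛ D (√Q ⊛ Ψ)                                ≋⟨ ⊛-congʳ √Q (D-⊛ √Q Ψ) ⟩
      √Q ⊛ ((D √Q ⊛ Ψ) ⊕ (√Q ⊛ D Ψ))                 ≋⟨ ⊛-distribˡ-⊕ √Q (D √Q ⊛ Ψ) (√Q ⊛ D Ψ) ⟩
      (√Q ⊛ (D √Q ⊛ Ψ)) ⊕ (√Q ⊛ (√Q ⊛ D Ψ))          ≋⟨ ⊕-cong (≋-sym (⊛-assoc √Q (D √Q) Ψ)) (≋-sym (⊛-assoc √Q √Q (D Ψ))) ⟩
      ((√Q ⊛ D √Q) ⊛ Ψ) ⊕ ((√Q ⊛ √Q) ⊛ D Ψ)          ≋⟨ ⊕-cong (⊛-congˡ √Q⊛D√Q≋X Ψ) (⊛-congˡ √Q⊛√Q≋Q (D Ψ)) ⟩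
      (X ⊛ Ψ) ⊕ (Q ⊛ D Ψ)                            ∎ˢ

    xΨ+QΨ′≋t·twoCosh : (X ⊛ Ψ) ⊕ (Q ⊛ D Ψ) ≋ t · twoCosh
    xΨ+QΨ′≋t·twoCosh = ≋-trans (≋-sym √Q⊛D-twoSinh≋xΨ+QΨ′) √Q⊛D-twoSinh

    Ψ-ode : D ((X ⊛ Ψ) ⊕ (Q ⊛ D Ψ)) ≋ (t * t) · Ψ
    Ψ-ode = ⊛-cancelˡ √Q √Q-0≢0 (
      √Q ⊛ D ((X ⊛ Ψ) ⊕ (Q ⊛ D Ψ))     ≋⟨ ⊛-congʳ √Q (≋-trans (D-cong xΨ+QΨ′≋t·twoCosh) (D-· t twoCosh)) ⟩
      √Q ⊛ (t · D twoCosh)              ≋⟨ ⊛-·ʳ t √Q (D twoCosh) ⟩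
      t · (√Q ⊛ D twoCosh)              ≋⟨ ·-congʳ t √Q⊛D-twoCosh ⟩
      t · (t · twoSinh)                 ≋⟨ ·-assoc t t twoSinh ⟩
      (t * t) · twoSinh                 ≋⟨ ·-congʳ (t * t) (≋-sym √Q⊛Ψ≋twoSinh) ⟩
      (t * t) · (√Q ⊛ Ψ)                ≋⟨ ≋-sym (⊛-·ʳ (t * t) √Q Ψ) ⟩
      √Q ⊛ ((t * t) · Ψ)                ∎ˢ)

    Ψ-0 : Ψ 0 ≡ 0#
    Ψ-0 = trans (cong (_* invˢ √Q 0) (trans (cong₂ _-_ (α^-0 t) (α^-0 (- t))) (-‿inverseʳ 1#))) (zeroˡ _)

    -- Read off from the constant term of x Ψ + Q Ψ′ = t (αᵗ + α⁻ᵗ), which is 4 Ψ₁ = 2 t.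
    Ψ-1 : Ψ 1 ≡ t * ½
    Ψ-1 = *-cancelˡ (fromℕ 4) (fromℕ-suc≢0 3) (begin
      fromℕ 4 * Ψ 1
        ≡⟨ solve 1 (λ b → con (ℤ.+ 4) :* b := con (ℤ.+ 0) :+ (con (ℤ.+ 4) :* (con (ℤ.+ 1) :* b) :+ con (ℤ.+ 0))) refl (Ψ 1) ⟩
      0# + (fromℕ 4 * D Ψ 0 + 0#)
        ≡⟨ sym (cong₂ (λ a b → a + (fromℕ 4 * D Ψ 0 + b)) (X-⊛-0 Ψ) (X-⊛-0 (X ⊛ D Ψ))) ⟩
      (X ⊛ Ψ) 0 + (fromℕ 4 * D Ψ 0 + (X ⊛ (X ⊛ D Ψ)) 0)
        ≡⟨ cong ((X ⊛ Ψ) 0 +_) (sym (Q-⊛ (D Ψ) 0)) ⟩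
      ((X ⊛ Ψ) ⊕ (Q ⊛ D Ψ)) 0
        ≡⟨ at xΨ+QΨ′≋t·twoCosh 0 ⟩
      t * (α^ t 0 + α^ (- t) 0)
        ≡⟨ cong (t *_) (trans (cong₂ _+_ (α^-0 t) (α^-0 (- t))) (cong (1# +_) (sym fromℕ-1))) ⟩
      t * 2#
        ≡⟨ solve 2 (λ t h → t :* con (ℤ.+ 2) := t :* con (ℤ.+ 2) :* con (ℤ.+ 1)) refl t ½ ⟩
      t * 2# * fromℕ 1
        ≡⟨ cong (t * 2# *_) (sym 2*½≡1) ⟩
      t * 2# * (2# * ½)
        ≡⟨ solve 2 (λ t h → t :* con (ℤ.+ 2) :* (con (ℤ.+ 2) :* h) := con (ℤ.+ 4) :* (t :* h)) refl t ½ ⟩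
      fromℕ 4 * (t * ½) ∎)

  prodBelow-suc : ∀ m f → prodBelow (suc m) f ≡ f 0 * prodBelow m (λ i → f (suc i))
  prodBelow-suc zero    f = trans (*-identityˡ _) (sym (*-identityʳ _))
  prodBelow-suc (suc m) f = trans (cong (_* f (suc m)) (prodBelow-suc m f)) (*-assoc _ _ _)

  binom-absorb : ∀ w k → fromℕ (suc k) * binom w (suc k) ≡ w * binom (w - 1#) k
  binom-absorb w k = begin
    A * (prodBelow (suc k) f * fromℕ (suc k ℕ.* k ℕ.!) ⁻¹)
      ≡⟨ cong₂ (λ p z → A * (p * z)) (trans (prodBelow-suc k f) (cong₂ _*_ f-0 (prodBelow-cong k f-suc)))
                                     (trans (cong _⁻¹ (fromℕ-* (suc k) (k ℕ.!))) (⁻¹-* A C (fromℕ-suc≢0 k) (fromℕ-!≢0 k))) ⟩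
    A * ((w * P) * (A ⁻¹ * C ⁻¹))
      ≡⟨ solve 5 (λ a w p a⁻¹ c⁻¹ → a :* ((w :* p) :* (a⁻¹ :* c⁻¹)) := (a :* a⁻¹) :* (w :* (p :* c⁻¹))) refl A w P (A ⁻¹) (C ⁻¹) ⟩
    (A * A ⁻¹) * (w * (P * C ⁻¹))
      ≡⟨ trans (cong (_* (w * (P * C ⁻¹))) (⁻¹-inverseʳ A (fromℕ-suc≢0 k))) (*-identityˡ _) ⟩
    w * binom (w - 1#) k ∎
    where
    A = fromℕ (suc k)
    C = fromℕ (k ℕ.!)
    P = prodBelow k (λ i → (w - 1#) - fromℕ i)
    f : ℕ → Carrier
    f i = w - fromℕ i
    f-0 : f 0 ≡ w
    f-0 = trans (cong (w +_) -0#≈0#) (+-identityʳ w)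
    f-suc : ∀ i → f (suc i) ≡ (w - 1#) - fromℕ i
    f-suc i = solve 3 (λ w o x → w :- (o :+ x) := (w :- o) :- x) refl w 1# (fromℕ i)
    prodBelow-cong : ∀ m {g h} → (∀ i → g i ≡ h i) → prodBelow m g ≡ prodBelow m h
    prodBelow-cong zero    _   = refl
    prodBelow-cong (suc m) g≡h = cong₂ _*_ (prodBelow-cong m g≡h) (g≡h m)

  Φ₀-even : ∀ t k → Φ₀ t (k ℕ.* 2) ≡ 0#
  Φ₀-even t zero    = refl
  Φ₀-even t (suc k) rewrite m*n%n≡0 k 2 ⦃ _ ⦄ = refl

  [1+k*2]/2≡k : ∀ k → suc (k ℕ.* 2) ℕ./ 2 ≡ k
  [1+k*2]/2≡k zero    = refl
  [1+k*2]/2≡k (suc k) =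
    trans (m/n≡1+[m∸n]/n {suc (suc (suc (k ℕ.* 2)))} {2} (s≤s (s≤s z≤n))) (cong suc ([1+k*2]/2≡k k))

  Φ₀-odd : ∀ t k → Φ₀ t (suc (k ℕ.* 2)) ≡ binom (t * ½ + fromℕ k) (suc (k ℕ.* 2))
  Φ₀-odd t zero    = cong (λ z → binom z 1) (sym (+-identityʳ (t * ½)))
  Φ₀-odd t (suc k) rewrite [m+kn]%n≡m%n 1 k 2 ⦃ _ ⦄ | [1+k*2]/2≡k k = refl

  binom-suc-suc : ∀ w k →
    fromℕ (suc k) * (fromℕ (suc (suc k)) * binom w (suc (suc k))) ≡ w * (binom (w - 1#) k * ((w - 1#) - fromℕ k))
  binom-suc-suc w k = begin
    A * (fromℕ (suc (suc k)) * binom w (suc (suc k)))   ≡⟨ cong (A *_) (binom-absorb w (suc k)) ⟩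
    A * (w * binom (w - 1#) (suc k))                    ≡⟨ solve 3 (λ a w b → a :* (w :* b) := w :* (a :* b)) refl A w _ ⟩
    w * (A * binom (w - 1#) (suc k))                    ≡⟨ cong (w *_) (binom-suc (w - 1#) k) ⟩
    w * (binom (w - 1#) k * ((w - 1#) - fromℕ k))       ∎
    where
    A = fromℕ (suc k)

  Φ₀-recurrence-even : ∀ t k → Recurrence t (Φ₀ t) (k ℕ.* 2)
  Φ₀-recurrence-even t k = begin
    A * (A * Φ₀ t (k ℕ.* 2) + fromℕ 4 * (B * Φ₀ t (suc k ℕ.* 2)))
      ≡⟨ cong₂ (λ a b → A * (A * a + fromℕ 4 * (B * b))) (Φ₀-even t k) (Φ₀-even t (suc k)) ⟩
    A * (A * 0# + fromℕ 4 * (B * 0#))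
      ≡⟨ solve 3 (λ a b c → a :* (a :* con (ℤ.+ 0) :+ con (ℤ.+ 4) :* (b :* con (ℤ.+ 0))) := c :* con (ℤ.+ 0)) refl A B (t * t) ⟩
    (t * t) * 0#
      ≡⟨ cong ((t * t) *_) (sym (Φ₀-even t k)) ⟩
    (t * t) * Φ₀ t (k ℕ.* 2) ∎
    where
    A = fromℕ (suc (k ℕ.* 2))
    B = fromℕ (suc (suc (k ℕ.* 2)))

  -- With u = t/2: (2k+2)² c + 4 (u+k+1)(u-k-1) c = 4u² c.
  Φ₀-recurrence-odd : ∀ t k → Recurrence t (Φ₀ t) (suc (k ℕ.* 2))
  Φ₀-recurrence-odd t k = begin
    A * (A * Φ₀ t n + fromℕ 4 * (B * Φ₀ t (suc (suc n))))
      ≡⟨ cong₂ (λ a b → A * (A * a + fromℕ 4 * (B * b))) (Φ₀-odd t k) (Φ₀-odd t (suc k)) ⟩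
    A * (A * c + fromℕ 4 * (B * binom w (suc (suc n))))
      ≡⟨ solve 4 (λ a c f b → a :* (a :* c :+ con (ℤ.+ 4) :* (f :* b)) := a :* a :* c :+ con (ℤ.+ 4) :* (a :* (f :* b)))
               refl A c B (binom w (suc (suc n))) ⟩
    A * A * c + fromℕ 4 * (A * (B * binom w (suc (suc n))))
      ≡⟨ cong (λ z → A * A * c + fromℕ 4 * z) (binom-suc-suc w n) ⟩
    A * A * c + fromℕ 4 * (w * (binom (w - 1#) n * ((w - 1#) - fromℕ n)))
      ≡⟨ cong (λ z → A * A * c + fromℕ 4 * (w * (binom z n * (z - fromℕ n)))) w-1≡u+K ⟩
    A * A * c + fromℕ 4 * (w * (c * ((u + K) - fromℕ n)))
      ≡⟨ cong₂ (λ a z → a * a * c + fromℕ 4 * (z * (c * ((u + K) - fromℕ n)))) A≡2+2K w≡u+1+K ⟩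
    (fromℕ 2 + K * 2#) * (fromℕ 2 + K * 2#) * c + fromℕ 4 * ((u + (fromℕ 1 + K)) * (c * ((u + K) - fromℕ n)))
      ≡⟨ cong (λ z → (fromℕ 2 + K * 2#) * (fromℕ 2 + K * 2#) * c
                      + fromℕ 4 * ((u + (fromℕ 1 + K)) * (c * ((u + K) - z)))) n≡1+2K ⟩
    (fromℕ 2 + K * 2#) * (fromℕ 2 + K * 2#) * c
      + fromℕ 4 * ((u + (fromℕ 1 + K)) * (c * ((u + K) - (fromℕ 1 + K * 2#))))
      ≡⟨ solve 4 (λ K c t h →
           (con (ℤ.+ 2) :+ K :* con (ℤ.+ 2)) :* (con (ℤ.+ 2) :+ K :* con (ℤ.+ 2)) :* c
             :+ con (ℤ.+ 4) :* ((t :* h :+ (con (ℤ.+ 1) :+ K))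
                  :* (c :* ((t :* h :+ K) :- (con (ℤ.+ 1) :+ K :* con (ℤ.+ 2)))))
           := (t :* t) :* c :* ((con (ℤ.+ 2) :* h) :* (con (ℤ.+ 2) :* h)))
           refl K c t ½ ⟩
    (t * t) * c * ((2# * ½) * (2# * ½))
      ≡⟨ cong (λ z → (t * t) * c * (z * z)) 2*½≡1 ⟩
    (t * t) * c * (fromℕ 1 * fromℕ 1)
      ≡⟨ solve 2 (λ s c → s :* c :* (con (ℤ.+ 1) :* con (ℤ.+ 1)) := s :* c) refl (t * t) c ⟩
    (t * t) * c
      ≡⟨ cong ((t * t) *_) (sym (Φ₀-odd t k)) ⟩
    (t * t) * Φ₀ t n ∎
    where
    n = suc (k ℕ.* 2)
    A = fromℕ (suc n)
    B = fromℕ (suc (suc n))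
    K = fromℕ k
    u = t * ½
    c = binom (u + K) n
    w = u + fromℕ (suc k)
    w-1≡u+K : w - 1# ≡ u + K
    w-1≡u+K = solve 3 (λ u o K → (u :+ (o :+ K)) :- o := u :+ K) refl u 1# K
    A≡2+2K : A ≡ fromℕ 2 + K * 2#
    A≡2+2K = trans (fromℕ-+ 2 (k ℕ.* 2)) (cong (fromℕ 2 +_) (fromℕ-* k 2))
    w≡u+1+K : w ≡ u + (fromℕ 1 + K)
    w≡u+1+K = cong (u +_) (fromℕ-+ 1 k)
    n≡1+2K : fromℕ n ≡ fromℕ 1 + K * 2#
    n≡1+2K = trans (fromℕ-+ 1 (k ℕ.* 2)) (cong (fromℕ 1 +_) (fromℕ-* k 2))

  Φ₀≋Ψ : ∀ t → Φ₀ t ≋ Ψ t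
  Φ₀≋Ψ t = recurrence-unique t (Φ₀ t) (Ψ t) (sym (Ψ-0 t)) (trans (binom-1 (t * ½)) (sym (Ψ-1 t)))
    (by-parity (Recurrence t (Φ₀ t)) (Φ₀-recurrence-even t) (Φ₀-recurrence-odd t))
    (ode⇒recurrence t (Ψ t) (Ψ-ode t))

  -- sinh and its inverse

  sinhˢ-expˢ : ∀ z → sinhˢ z ≋ ½ · (expˢ z ⊖ expˢ ((- 1#) · z))
  sinhˢ-expˢ z = mk≋ λ N → sym (begin
    ½ * (sumTo N (λ n → e n * zⁿ n N) - sumTo N (λ n → e n * (((- 1#) · z) ^ˢ n) N))
      ≡⟨ cong (λ w → ½ * (sumTo N (λ n → e n * zⁿ n N) + w)) (-‿distrib-sumTo N _) ⟩
    ½ * (sumTo N (λ n → e n * zⁿ n N) + sumTo N (λ n → - (e n * (((- 1#) · z) ^ˢ n) N)))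
      ≡⟨ trans (cong (½ *_) (sym (sumTo-+ N _ _))) (*-distribˡ-sumTo N ½ _) ⟩
    sumTo N (λ n → ½ * (e n * zⁿ n N + - (e n * (((- 1#) · z) ^ˢ n) N)))
      ≡⟨ sumTo-cong N (λ n → term N n) ⟩
    sumTo N (λ n → sinhSeries n * zⁿ n N) ∎)
    where
    e = expSeries
    zⁿ : ℕ → FPS
    zⁿ n = z ^ˢ n
    term : ∀ N n → ½ * (e n * zⁿ n N + - (e n * (((- 1#) · z) ^ˢ n) N)) ≡ sinhSeries n * zⁿ n N
    term N n = begin
      ½ * (e n * zⁿ n N + - (e n * (((- 1#) · z) ^ˢ n) N))
        ≡⟨ cong (λ w → ½ * (e n * zⁿ n N + - (e n * w))) (at (·-^ˢ (- 1#) z n) N) ⟩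
      ½ * (e n * zⁿ n N + - (e n * ((- 1#) ^ n * zⁿ n N)))
        ≡⟨ solve 4 (λ h e Z s → h :* (e :* Z :+ :- (e :* (s :* Z))) := ((con (ℤ.+ 1) :- s) :* h) :* e :* Z)
                 refl ½ (e n) (zⁿ n N) ((- 1#) ^ n) ⟩
      ((fromℕ 1 - ((- 1#) ^ n)) * ½) * e n * zⁿ n N
        ≡⟨ cong (λ o → ((o - ((- 1#) ^ n)) * ½) * e n * zⁿ n N) fromℕ-1 ⟩
      sinhSeries n * zⁿ n N ∎

  sinhSeries-0 : sinhSeries 0 ≡ 0#
  sinhSeries-0 = begin
    ((1# - 1#) * ½) * expSeries 0   ≡⟨ cong (λ z → (z * ½) * expSeries 0) (-‿inverseʳ 1#) ⟩
    (0# * ½) * expSeries 0          ≡⟨ trans (cong (_* expSeries 0) (zeroˡ ½)) (zeroˡ _) ⟩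
    0#                              ∎

  expˢ-logα : expˢ logα ≋ α
  expˢ-logα = linear-ode-unique (expˢ logα) α (D logα) (D-expˢ logα logα-0) (≋-sym α⊛D-logα)
    (trans (trans (∘ˢ-0 expSeries logα) fromℕ-1⁻¹) (sym α-0))

  -- (α⁻¹ α)′ = α⁻¹ (-logα′) α + α⁻¹ α′ = 0.
  α⁻¹⊛α≋1 : α^ (- 1#) ⊛ α ≋ 1ˢ
  α⁻¹⊛α≋1 = linear-ode-unique (α⁻¹ ⊛ α) 1ˢ 0ˢ
    (≋-trans D[α⁻¹⊛α]≋0 (≋-sym (⊛-zeroʳ (α⁻¹ ⊛ α))))
    (≋-trans (D-const 1#) (≋-sym (⊛-zeroʳ 1ˢ)))
    (trans (cong₂ _*_ (α^-0 (- 1#)) α-0) (*-identityˡ 1#))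
    where
    α⁻¹ = α^ (- 1#)
    Z = α⁻¹ ⊛ (α ⊛ D logα)
    D[α⁻¹⊛α]≋0 : D (α⁻¹ ⊛ α) ≋ 0ˢ
    D[α⁻¹⊛α]≋0 =
      D (α⁻¹ ⊛ α)
        ≋⟨ D-⊛ α⁻¹ α ⟩
      (D α⁻¹ ⊛ α) ⊕ (α⁻¹ ⊛ D α)
        ≋⟨ ⊕-cong (⊛-congˡ (≋-trans (D-expˢ ((- 1#) · logα) (t·logα-0 (- 1#))) (⊛-congʳ α⁻¹ (D-· (- 1#) logα))) α)
                  (⊛-congʳ α⁻¹ (≋-sym α⊛D-logα)) ⟩
      ((α⁻¹ ⊛ ((- 1#) · D logα)) ⊛ α) ⊕ Z
        ≋⟨ ⊕-cong (≋-trans (⊛-congˡ (⊛-·ʳ (- 1#) α⁻¹ (D logα)) α) (⊛-·ˡ (- 1#) (α⁻¹ ⊛ D logα) α)) (≋-refl {Z}) ⟩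
      ((- 1#) · ((α⁻¹ ⊛ D logα) ⊛ α)) ⊕ Z
        ≋⟨ ⊕-cong (·-congʳ (- 1#) (≋-trans (⊛-assoc α⁻¹ (D logα) α) (⊛-congʳ α⁻¹ (⊛-comm (D logα) α)))) (≋-refl {Z}) ⟩
      ((- 1#) · Z) ⊕ Z
        ≋⟨ mk≋ (λ n → trans (cong (_+ Z n) (-1*x≈-x (Z n))) (-‿inverseˡ (Z n))) ⟩
      0ˢ ∎ˢ

  α⊛α≋x⊛α+1 : α ⊛ α ≋ (X ⊛ α) ⊕ 1ˢ
  α⊛α≋x⊛α+1 = mk≋ λ n → begin
    (α ⊛ α) n
      ≡⟨ trans (at (⊛-·ˡ ½ x+√Q α) n) (cong (½ *_) (at (⊛-·ʳ ½ x+√Q x+√Q) n)) ⟩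
    ½ * (½ * (x+√Q ⊛ x+√Q) n)
      ≡⟨ cong (λ z → ½ * (½ * z)) (trans (at (⊛-distribʳ-⊕ x+√Q X √Q) n)
                                          (cong₂ _+_ (at (⊛-distribˡ-⊕ X X √Q) n) (at (⊛-distribˡ-⊕ √Q X √Q) n))) ⟩
    ½ * (½ * ((a n + b n) + ((√Q ⊛ X) n + (√Q ⊛ √Q) n)))
      ≡⟨ cong₂ (λ p q → ½ * (½ * ((a n + b n) + (p + q)))) (at (⊛-comm √Q X) n) (at √Q⊛√Q≋Q n) ⟩
    ½ * (½ * ((a n + b n) + (b n + (a n + const (fromℕ 4) n))))
      ≡⟨ cong (λ z → ½ * (½ * ((a n + b n) + (b n + (a n + z))))) (const-4 n) ⟩
    ½ * (½ * ((a n + b n) + (b n + (a n + fromℕ 4 * 1ˢ n))))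
      ≡⟨ solve 4 (λ h a b e → h :* (h :* ((a :+ b) :+ (b :+ (a :+ con (ℤ.+ 4) :* e))))
                           := h :* (con (ℤ.+ 2) :* h) :* (a :+ b) :+ (con (ℤ.+ 2) :* h) :* (con (ℤ.+ 2) :* h) :* e)
               refl ½ (a n) (b n) (1ˢ n) ⟩
    ½ * (2# * ½) * (a n + b n) + (2# * ½) * (2# * ½) * 1ˢ n
      ≡⟨ cong (λ u → ½ * u * (a n + b n) + u * u * 1ˢ n) 2*½≡1 ⟩
    ½ * fromℕ 1 * (a n + b n) + fromℕ 1 * fromℕ 1 * 1ˢ n
      ≡⟨ solve 4 (λ h a b e → h :* con (ℤ.+ 1) :* (a :+ b) :+ con (ℤ.+ 1) :* con (ℤ.+ 1) :* e := h :* (a :+ b) :+ e)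
               refl ½ (a n) (b n) (1ˢ n) ⟩
    ½ * (a n + b n) + 1ˢ n
      ≡⟨ cong (_+ 1ˢ n) (sym (trans (at (⊛-·ʳ ½ X x+√Q) n) (cong (½ *_) (at (⊛-distribˡ-⊕ X X √Q) n)))) ⟩
    ((X ⊛ α) ⊕ 1ˢ) n ∎
    where
    x+√Q = X ⊕ √Q
    a b : FPS
    a = X ⊛ X
    b = X ⊛ √Q
    const-4 : ∀ n → const (fromℕ 4) n ≡ fromℕ 4 * 1ˢ n
    const-4 zero    = sym (*-identityʳ _)
    const-4 (suc n) = sym (zeroʳ _)

  α-α⁻¹≋x : α ⊖ α^ (- 1#) ≋ X
  α-α⁻¹≋x = ⊛-cancelˡ α α-0≢0 (
    α ⊛ (α ⊖ α^ (- 1#))            ≋⟨ ⊛-distribˡ-⊖ α α (α^ (- 1#)) ⟩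
    (α ⊛ α) ⊖ (α ⊛ α^ (- 1#))      ≋⟨ ⊖-cong α⊛α≋x⊛α+1 (≋-trans (⊛-comm α (α^ (- 1#))) α⁻¹⊛α≋1) ⟩
    ((X ⊛ α) ⊕ 1ˢ) ⊖ 1ˢ            ≋⟨ mk≋ (λ n → solve 2 (λ x e → (x :+ e) :- e := x) refl _ _) ⟩
    X ⊛ α                          ≋⟨ ⊛-comm X α ⟩
    α ⊛ X                          ∎ˢ)

  sinhˢ-logα : sinhˢ logα ≋ ½ · X
  sinhˢ-logα =
    sinhˢ logα                                        ≋⟨ sinhˢ-expˢ logα ⟩
    ½ · (expˢ logα ⊖ expˢ ((- 1#) · logα))            ≋⟨ ·-congʳ ½ (⊖-cong expˢ-logα (≋-refl {α^ (- 1#)})) ⟩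
    ½ · (α ⊖ α^ (- 1#))                               ≋⟨ ·-congʳ ½ α-α⁻¹≋x ⟩
    ½ · X                                             ∎ˢ

  asinh-½x≋logα : ∀ asinh → IsSinhInverse asinh → asinh ∘ˢ (½ · X) ≋ logα
  asinh-½x≋logα asinh (_ , _ , asinh∘sinh≈x) =
    asinh ∘ˢ (½ · X)                     ≋⟨ ∘ˢ-congʳ asinh (≋-sym sinhˢ-logα) ⟩
    asinh ∘ˢ (sinhSeries ∘ˢ logα)        ≋⟨ ≋-sym (∘ˢ-assoc asinh sinhSeries logα sinhSeries-0 logα-0) ⟩
    (asinh ∘ˢ sinhSeries) ∘ˢ logα        ≋⟨ ∘ˢ-congˡ (mk≋ asinh∘sinh≈x) logα ⟩
    X ∘ˢ logα                            ≋⟨ X-∘ˢ logα logα-0 ⟩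
    logα                                 ∎ˢ

  2sinh[t·asinh-½x]≋twoSinh : ∀ asinh → IsSinhInverse asinh → ∀ t →
    2# · sinhˢ (t · (asinh ∘ˢ (½ · X))) ≋ twoSinh t
  2sinh[t·asinh-½x]≋twoSinh asinh inv t =
    2# · sinhˢ (t · (asinh ∘ˢ (½ · X)))
      ≋⟨ ·-congʳ 2# (∘ˢ-congʳ sinhSeries (·-congʳ t (asinh-½x≋logα asinh inv))) ⟩
    2# · sinhˢ (t · logα)
      ≋⟨ ·-congʳ 2# (sinhˢ-expˢ (t · logα)) ⟩
    2# · (½ · (α^ t ⊖ expˢ ((- 1#) · (t · logα))))
      ≋⟨ ·-congʳ 2# (·-congʳ ½ (⊖-cong (≋-refl {α^ t}) (∘ˢ-congʳ expSeries (mk≋ λ n →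
           trans (-1*x≈-x (t * logα n)) (-‿distribˡ-* t (logα n)))))) ⟩
    2# · (½ · twoSinh t)
      ≋⟨ ≋-trans (·-assoc 2# ½ (twoSinh t)) (·-congˡ (trans 2*½≡1 fromℕ-1) (twoSinh t)) ⟩
    1# · twoSinh t
      ≋⟨ mk≋ (λ _ → *-identityˡ _) ⟩
    twoSinh t ∎ˢ

mainTheorem1 : (ℝ : RealField) → let open Series ℝ in
    (t : Carrier) →
    (Φ₀ t ≈ (α^ t ⊖ α^ (- t)) ⊛ invˢ sqrtX²+4)
    × ((asinh : FPS) → IsSinhInverse asinh →
    Φ₀ t ≈ (2# · sinhˢ (t · (asinh ∘ˢ ((2# ⁻¹) · X)))) ⊛ invˢ sqrtX²+4)
mainTheorem1 ℝ t =
    at (Φ₀≋Ψ t)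
  , λ asinh inv → at (≋-trans (Φ₀≋Ψ t) (≋-sym (⊛-congˡ (2sinh[t·asinh-½x]≋twoSinh asinh inv t) (invˢ √Q))))
  where
  open Series ℝ
  open Development ℝ
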